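{- Let $\mathcal{B}$ be the set of Catalan words avoiding the pattern $(\geq,\geq)$ that do not end with two letters $ab$ satisfying $a\ge b$, and let \[ H(x,q)=\sum_{w\in\mathcal{B},\,w\ne\epsilon}x^{|w|}q^{\mathrm{inter}(w)}. \] Then \[ H(x,q)=\frac{\sum_{j\geq1}x^j\prod_{i=1}^{j-1}\left(q^{i-1}-\frac{1}{1-q^i}\right)} {1-\sum_{j\geq1}\frac{x^j}{1-q^j}\prod_{i=1}^{j-1}\left(q^{i-1}-\frac{1}{1-q^i}\right)}. \]
   Context: A Catalan word of length $n\ge 0$ is a sequence $w=w_1\cdots w_n$ of non-negative integers with $w_1=0$ and $0\le w_i\le w_{i-1}+1$ for $i=2,\dots,n$; $|w|$ is its length and $\epsilon$ the empty word. It avoids the pattern $(\geq,\geq)$ if there is no index $i$ with $w_i\ge w_{i+1}\ge w_{i+2}$. To $w$ is associated the polyomino $P(w)$ with $n$ bottom-aligned columns, the $i$-th column consisting of $w_i+1$ unit cells. $\mathrm{inter}(w)$ is the number of lattice points belonging to exactly four cells of $P(w)$. -}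

module Defs where

open import Data.Bool using (Bool; true; false; _∧_; not; if_then_else_)
open import Data.Nat using (ℕ; zero; suc; _∸_; _≤ᵇ_; _≡ᵇ_; _⊔_; _≟_)
open import Data.Nat.Divisibility using (_∣?_)
open import Data.Integer using (ℤ; +_; -_) renaming (_+_ to _+ℤ_; _*_ to _*ℤ_)
open import Data.List using (List; []; _∷_; length; map; filter; concatMap; foldr; upTo; zip; sum)
open import Relation.Nullary.Decidable using (does)
open import Data.Product using (_×_; _,_; proj₁; proj₂)

stepsOK : ℕ → List ℕ → Bool
stepsOK prev []       = true
stepsOK prev (y ∷ ys) = (y ≤ᵇ suc prev) ∧ stepsOK y ys

isCatalan : List ℕ → Bool
isCatalan []       = true
isCatalan (x ∷ xs) = (x ≡ᵇ 0) ∧ stepsOK x xs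

avoidsGeGe : List ℕ → Bool
avoidsGeGe (a ∷ b ∷ c ∷ r) = not ((b ≤ᵇ a) ∧ (c ≤ᵇ b)) ∧ avoidsGeGe (b ∷ c ∷ r)
avoidsGeGe _ = true

endsWithWeakDescent : List ℕ → Bool
endsWithWeakDescent (a ∷ b ∷ [])    = b ≤ᵇ a
endsWithWeakDescent (a ∷ b ∷ c ∷ r) = endsWithWeakDescent (b ∷ c ∷ r)
endsWithWeakDescent _ = false

inB : List ℕ → Bool
inB w = isCatalan w ∧ avoidsGeGe w ∧ not (endsWithWeakDescent w)

-- Cells of P(w): the cell in (0-based) column c and row r is the unit
-- square [c, c+1] × [r, r+1]; column c (holding letter v) has the v+1
-- cells r = 0 .. v, all bottom-aligned.
cells : List ℕ → List (ℕ × ℕ)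
cells w = concatMap (λ p → map (λ r → (proj₁ p , r)) (upTo (suc (proj₂ p))))
                    (zip (upTo (length w)) w)

pointInCell : ℕ × ℕ → ℕ × ℕ → Bool
pointInCell (x , y) (c , r) = (c ≤ᵇ x) ∧ (x ≤ᵇ suc c) ∧ (r ≤ᵇ y) ∧ (y ≤ᵇ suc r)

cellsContaining : List ℕ → ℕ × ℕ → ℕ
cellsContaining w p = length (filter (λ c → pointInCell p c ≟ᵇ true) (cells w))
  where
  open import Data.Bool.Properties using () renaming (_≟_ to _≟ᵇ_)

-- All lattice points that can possibly touch P(w):
-- 0 ≤ x ≤ |w|, 0 ≤ y ≤ max(w) + 1.
candidatePoints : List ℕ → List (ℕ × ℕ)
candidatePoints w =
  concatMap (λ x → map (λ y → (x , y)) (upTo (suc (suc (foldr _⊔_ 0 w)))))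
            (upTo (suc (length w)))

inter : List ℕ → ℕ
inter w = length (filter (λ p → cellsContaining w p ≟ 4) (candidatePoints w))

-- Enumeration: all words of length n with letters in {0,…,k-1}.
-- (Every Catalan word of length n has letters < n.)
wordsBelow : ℕ → ℕ → List (List ℕ)
wordsBelow zero    k = [] ∷ []
wordsBelow (suc n) k = concatMap (λ a → map (a ∷_) (wordsBelow n k)) (upTo k)

-- Formal power series.
-- QS : series in q with integer coefficients (coefficient of q^m).
-- XS : series in x with coefficients in ℤ[[q]] (coefficient of x^n q^m).

QS : Set
QS = ℕ → ℤ

XS : Set
XS = ℕ → QS

zeroQ : QS
zeroQ _ = + 0

oneQ : QS
oneQ zero    = + 1
oneQ (suc _) = + 0

qpow : ℕ → QS
qpow k m = if (k ≡ᵇ m) then + 1 else + 0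

_-Q_ : QS → QS → QS
(f -Q g) m = f m +ℤ (- g m)

_*Q_ : QS → QS → QS
(f *Q g) m = sumℤ (map (λ k → f k *ℤ g (m ∸ k)) (upTo (suc m)))
  where
  sumℤ : List ℤ → ℤ
  sumℤ = foldr _+ℤ_ (+ 0)

-- 1/(1 - q^i) = Σ_{k ≥ 0} q^{ik}  (used only for i ≥ 1)
invOneMinusQPow : ℕ → QS
invOneMinusQPow i m = if does (i ∣? m) then + 1 else + 0

oneX : XS
oneX zero    = oneQ
oneX (suc _) = zeroQ

_*X_ : XS → XS → XS
(F *X G) n m = foldr _+ℤ_ (+ 0) (map (λ k → (F k *Q G (n ∸ k)) m) (upTo (suc n)))

_^X_ : XS → ℕ → XS
F ^X zero    = oneX
F ^X (suc k) = F *X (F ^X k)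

-- 1/(1 - D) = Σ_{k ≥ 0} D^k for a series D with zero constant term in x;
-- the coefficient of x^n only involves k ≤ n.
invOneMinusX : XS → XS
invOneMinusX D n m = foldr _+ℤ_ (+ 0) (map (λ k → (D ^X k) n m) (upTo (suc n)))

Hcoeff : XS
Hcoeff zero    m = + 0
Hcoeff (suc n) m =
  + length (filter (λ w → (inB w ∧ (inter w ≡ᵇ m)) ≟ᵇ true) (wordsBelow (suc n) (suc n)))
  where
  open import Data.Bool.Properties using () renaming (_≟_ to _≟ᵇ_)

factor : ℕ → QS
factor i = qpow (i ∸ 1) -Q invOneMinusQPow i

prodFactors : ℕ → QS
prodFactors j = foldr _*Q_ oneQ (map (λ i → factor (suc i)) (upTo (j ∸ 1)))

numer : XS
numer zero    = zeroQ
numer (suc j) = prodFactors (suc j)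

denomSum : XS
denomSum zero    = zeroQ
denomSum (suc j) = invOneMinusQPow (suc j) *Q prodFactors (suc j)

rhs : XS
rhs = numer *X invOneMinusX denomSum

{-# OPTIONS --safe #-}
module Submission where

open import Defs
open import Algebra.Bundles using (CommutativeRing; Semiring)
open import Algebra.Structures using (IsCommutativeRing)
open import Data.Nat using (ℕ; zero; suc; _∸_; _<_; _≤_; z≤n; s≤s; _≤ᵇ_)
open import Data.Nat.Properties using (≤-trans; ∸-monoʳ-<; m∸n≤m; n≤1+n)
open import Data.Fin using (toℕ)
open import Data.Fin.Properties using (toℕ-inject₁; toℕ-fromℕ; toℕ<n)
open import Data.Product using (_,_)
open import Relation.Binary.Structures using (IsEquivalence)
open import Relation.Binary.PropositionalEquality using (_≡_)
import Relation.Binary.PropositionalEquality as ≡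

-- inter(w) is the sum of min(wᵢ, wᵢ₊₁) over adjacent letters. In a word of 𝓑 a letter h is
-- followed either by h + 1 (a rise, adding h to inter) or, directly after a rise only, by some
-- y ≤ h (a weak fall, adding y), after which the word must rise again. Hence the series Fₕ and
-- Dₕ of continuations after a rise, resp. a fall, to h satisfy, with mₕ = q^h x,
--   Fₕ = 1 + mₕ Fₕ₊₁ + Σ_{y≤h} m_y D_y,   Dₕ = mₕ Fₕ₊₁,   H = x F₀.
-- Then Tₕ = (1 + m₀)⋯(1 + mₕ₋₁) Fₕ solves Tₕ = 1 + Σ_{d<h} m_d T_d + mₕ Tₕ₊₁, a system whose
-- power-series solution is unique since the mₕ have no constant term. Writing the right-hand
-- side as N/(1 − S), the series αₕ/(1 − S) with αₕ = N(q^h x)/(q^h x) solve the same system: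
-- this only uses the recursion aⱼ₊₁ = aⱼ (q^{j−1} − 1/(1 − q^j)) of the products in N and S,
-- and 1/(1 − q^j) = 1 + q^j/(1 − q^j). At h = 0 this gives H = x α₀/(1 − S) = N/(1 − S).

≤ᵇ-suc : ∀ h m → (suc h ≤ᵇ suc m) ≡ (h ≤ᵇ m)
≤ᵇ-suc zero    m = ≡.refl
≤ᵇ-suc (suc h) m = ≡.refl

module SumUpTo {c ℓ} (S : Semiring c ℓ) where

  open Semiring S
  open import Algebra.Properties.Semiring.Sum S
    using (sum; ∑-distrib-+; ∑-comm; *-distribˡ-sum; sum-init-last; sum-replicate-zero; sum-cong-≋)

  sumUpTo : ℕ → (ℕ → Carrier) → Carrier
  sumUpTo n f = sum {n} (λ i → f (toℕ i))

  sumUpTo-cong< : ∀ n {f g} → (∀ k → k < n → f k ≈ g k) → sumUpTo n f ≈ sumUpTo n g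
  sumUpTo-cong< n e = sum-cong-≋ {n} (λ i → e (toℕ i) (toℕ<n i))

  sumUpTo-cong : ∀ n {f g} → (∀ k → f k ≈ g k) → sumUpTo n f ≈ sumUpTo n g
  sumUpTo-cong n e = sum-cong-≋ {n} (λ i → e (toℕ i))

  sumUpTo-zero : ∀ n {f} → (∀ k → k < n → f k ≈ 0#) → sumUpTo n f ≈ 0#
  sumUpTo-zero n e = trans (sumUpTo-cong< n e) (sum-replicate-zero n)

  sumUpTo-+ : ∀ n f g → sumUpTo n (λ k → f k + g k) ≈ sumUpTo n f + sumUpTo n g
  sumUpTo-+ n f g = ∑-distrib-+ {n} (λ i → f (toℕ i)) (λ i → g (toℕ i))

  sumUpTo-*ˡ : ∀ n a f → a * sumUpTo n f ≈ sumUpTo n (λ k → a * f k)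
  sumUpTo-*ˡ n a f = *-distribˡ-sum {n} a (λ i → f (toℕ i))

  sumUpTo-comm : ∀ m n (f : ℕ → ℕ → Carrier) →
                 sumUpTo m (λ i → sumUpTo n (f i)) ≈ sumUpTo n (λ j → sumUpTo m (λ i → f i j))
  sumUpTo-comm m n f = ∑-comm {m} {n} (λ i j → f (toℕ i) (toℕ j))

  sumUpTo-suc : ∀ n f → sumUpTo (suc n) f ≈ sumUpTo n f + f n
  sumUpTo-suc n f = trans (sum-init-last (λ i → f (toℕ i)))
    (+-cong (sum-cong-≋ {n} (λ i → reflexive (≡.cong f (toℕ-inject₁ i))))
            (reflexive (≡.cong f (toℕ-fromℕ n))))

  sumUpTo-extend : ∀ {n N} f → n ≤ N → (∀ k → n ≤ k → k < N → f k ≈ 0#) →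
                   sumUpTo N f ≈ sumUpTo n f
  sumUpTo-extend {zero}  {N}     f _         e = sumUpTo-zero N (λ k → e k z≤n)
  sumUpTo-extend {suc n} {suc N} f (s≤s n≤N) e =
    +-congˡ (sumUpTo-extend (λ k → f (suc k)) n≤N (λ k n≤k k<N → e (suc k) (s≤s n≤k) (s≤s k<N)))

module PowerSeries {c ℓ} (R : CommutativeRing c ℓ) where

  open CommutativeRing R
  open SumUpTo semiring public
  open import Relation.Binary.Reasoning.Setoid setoid

  Series : Set c
  Series = ℕ → Carrier

  infix 4 _≋_
  record _≋_ (f g : Series) : Set ℓ where
    constructor coeffwise
    field coeff : ∀ n → f n ≈ g n
  open _≋_ public

  infixl 6 _⊕_
  infixl 7 _⊛_

  _⊕_ : Series → Series → Series
  (f ⊕ g) n = f n + g n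

  ⊝_ : Series → Series
  (⊝ f) n = - f n

  𝟘 : Series
  𝟘 _ = 0#

  const : Carrier → Series
  const a zero    = a
  const a (suc _) = 0#

  𝟙 : Series
  𝟙 = const 1#

  _⊛_ : Series → Series → Series
  (f ⊛ g) n = sumUpTo (suc n) (λ k → f k * g (n ∸ k))

  scale : Carrier → Series → Series
  scale a f n = a * f n

  shift : Series → Series
  shift f zero    = 0#
  shift f (suc n) = f n

  shift-cong : ∀ {f g} → f ≋ g → shift f ≋ shift g
  shift-cong f≋g = coeffwise λ where
    zero    → refl
    (suc n) → coeff f≋g n

  ⊛-cong : ∀ {f f′ g g′} → f ≋ f′ → g ≋ g′ → f ⊛ g ≋ f′ ⊛ g′
  ⊛-cong f≋f′ g≋g′ = coeffwise λ n → sumUpTo-cong (suc n) λ k → *-cong (coeff f≋f′ k) (coeff g≋g′ (n ∸ k))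

  ⊛-suc : ∀ f g n → (f ⊛ g) (suc n) ≈ (f ⊛ (λ k → g (suc k))) n + f (suc n) * g 0
  ⊛-suc f g zero = begin
    f 0 * g 1 + (f 1 * g 0 + 0#)  ≈⟨ +-congˡ (+-identityʳ _) ⟩
    f 0 * g 1 + f 1 * g 0         ≈⟨ +-congʳ (+-identityʳ _) ⟨
    (f 0 * g 1 + 0#) + f 1 * g 0  ∎
  ⊛-suc f g (suc n) = begin
    f 0 * g (suc (suc n)) + (f′ ⊛ g) (suc n)
      ≈⟨ +-congˡ (⊛-suc f′ g n) ⟩
    f 0 * g (suc (suc n)) + ((f′ ⊛ (λ k → g (suc k))) n + f′ (suc n) * g 0)
      ≈⟨ +-assoc _ _ _ ⟨
    (f 0 * g (suc (suc n)) + (f′ ⊛ (λ k → g (suc k))) n) + f (suc (suc n)) * g 0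
      ∎
    where f′ = λ k → f (suc k)

  ⊛-comm : ∀ f g → f ⊛ g ≋ g ⊛ f
  ⊛-comm f g = coeffwise (comm-at f g)
    where
    comm-at : ∀ f g n → (f ⊛ g) n ≈ (g ⊛ f) n
    comm-at f g zero    = +-congʳ (*-comm (f 0) (g 0))
    comm-at f g (suc n) = begin
      f 0 * g (suc n) + ((λ k → f (suc k)) ⊛ g) n   ≈⟨ +-cong (*-comm _ _) (comm-at (λ k → f (suc k)) g n) ⟩
      g (suc n) * f 0 + (g ⊛ (λ k → f (suc k))) n   ≈⟨ +-comm _ _ ⟩
      (g ⊛ (λ k → f (suc k))) n + g (suc n) * f 0   ≈⟨ ⊛-suc g f n ⟨
      (g ⊛ f) (suc n)                               ∎

  ⊛-distribˡ : ∀ f g h → f ⊛ (g ⊕ h) ≋ f ⊛ g ⊕ f ⊛ h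
  ⊛-distribˡ f g h = coeffwise λ n → trans
    (sumUpTo-cong (suc n) λ k → distribˡ (f k) (g (n ∸ k)) (h (n ∸ k)))
    (sumUpTo-+ (suc n) (λ k → f k * g (n ∸ k)) (λ k → f k * h (n ∸ k)))

  ⊛-distribʳ : ∀ f g h → (g ⊕ h) ⊛ f ≋ g ⊛ f ⊕ h ⊛ f
  ⊛-distribʳ f g h = coeffwise λ n → begin
    ((g ⊕ h) ⊛ f) n        ≈⟨ coeff (⊛-comm (g ⊕ h) f) n ⟩
    (f ⊛ (g ⊕ h)) n        ≈⟨ coeff (⊛-distribˡ f g h) n ⟩
    (f ⊛ g) n + (f ⊛ h) n  ≈⟨ +-cong (coeff (⊛-comm f g) n) (coeff (⊛-comm f h) n) ⟩
    (g ⊛ f) n + (h ⊛ f) n  ∎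

  ⊛-scaleˡ : ∀ a f g → scale a f ⊛ g ≋ scale a (f ⊛ g)
  ⊛-scaleˡ a f g = coeffwise λ n → trans
    (sumUpTo-cong (suc n) λ k → *-assoc a (f k) (g (n ∸ k)))
    (sym (sumUpTo-*ˡ (suc n) a (λ k → f k * g (n ∸ k))))

  ⊛-assoc : ∀ f g h → (f ⊛ g) ⊛ h ≋ f ⊛ (g ⊛ h)
  ⊛-assoc f g h = coeffwise (assoc-at f g h)
    where
    assoc-at : ∀ f g h n → ((f ⊛ g) ⊛ h) n ≈ (f ⊛ (g ⊛ h)) n
    assoc-at f g h zero = +-congʳ (begin
      (f 0 * g 0 + 0#) * h 0  ≈⟨ *-congʳ (+-identityʳ _) ⟩
      (f 0 * g 0) * h 0       ≈⟨ *-assoc _ _ _ ⟩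
      f 0 * (g 0 * h 0)       ≈⟨ *-congˡ (+-identityʳ _) ⟨
      f 0 * (g 0 * h 0 + 0#)  ∎)
    assoc-at f g h (suc n) = begin
      (f 0 * g 0 + 0#) * h (suc n) + ((λ k → (f ⊛ g) (suc k)) ⊛ h) n
        ≈⟨ +-cong (*-congʳ (+-identityʳ _)) (coeff (⊛-distribʳ h (scale (f 0) g′) (f′ ⊛ g)) n) ⟩
      (f 0 * g 0) * h (suc n) + ((scale (f 0) g′ ⊛ h) n + ((f′ ⊛ g) ⊛ h) n)
        ≈⟨ +-cong (*-assoc _ _ _) (+-cong (coeff (⊛-scaleˡ (f 0) g′ h) n) (assoc-at f′ g h n)) ⟩
      f 0 * (g 0 * h (suc n)) + (f 0 * (g′ ⊛ h) n + (f′ ⊛ (g ⊛ h)) n)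
        ≈⟨ +-assoc _ _ _ ⟨
      (f 0 * (g 0 * h (suc n)) + f 0 * (g′ ⊛ h) n) + (f′ ⊛ (g ⊛ h)) n
        ≈⟨ +-congʳ (distribˡ _ _ _) ⟨
      f 0 * (g ⊛ h) (suc n) + (f′ ⊛ (g ⊛ h)) n
        ∎
      where
      f′ = λ k → f (suc k)
      g′ = λ k → g (suc k)

  const-⊛ : ∀ a f → const a ⊛ f ≋ scale a f
  const-⊛ a f = coeffwise λ n →
    trans (+-congˡ (sumUpTo-zero n {λ k → const a (suc k) * f (n ∸ suc k)} λ k _ → zeroˡ _)) (+-identityʳ _)

  shift-⊛ : ∀ f g → shift f ⊛ g ≋ shift (f ⊛ g)
  shift-⊛ f g = coeffwise λ where
    zero    → trans (+-identityʳ _) (zeroˡ _)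
    (suc n) → trans (+-congʳ (zeroˡ _)) (+-identityˡ _)

  ⊛-identityˡ : ∀ f → 𝟙 ⊛ f ≋ f
  ⊛-identityˡ f = coeffwise λ n → trans (coeff (const-⊛ 1# f) n) (*-identityˡ (f n))

  ≋-isEquivalence : IsEquivalence _≋_
  ≋-isEquivalence = record
    { refl  = coeffwise λ _ → refl
    ; sym   = λ f≋g → coeffwise λ n → sym (coeff f≋g n)
    ; trans = λ f≋g g≋h → coeffwise λ n → trans (coeff f≋g n) (coeff g≋h n)
    }

  ⊛-isCommutativeRing : IsCommutativeRing _≋_ _⊕_ _⊛_ ⊝_ 𝟘 𝟙
  ⊛-isCommutativeRing = record
    { isRing = record
      { +-isAbelianGroup = record
        { isGroup = record
          { isMonoid = record
            { isSemigroup = record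
              { isMagma = record
                { isEquivalence = ≋-isEquivalence
                ; ∙-cong = λ f≋f′ g≋g′ → coeffwise λ n → +-cong (coeff f≋f′ n) (coeff g≋g′ n)
                }
              ; assoc = λ f g h → coeffwise λ n → +-assoc (f n) (g n) (h n)
              }
            ; identity = (λ f → coeffwise λ n → +-identityˡ (f n))
                       , (λ f → coeffwise λ n → +-identityʳ (f n))
            }
          ; inverse = (λ f → coeffwise λ n → -‿inverseˡ (f n))
                    , (λ f → coeffwise λ n → -‿inverseʳ (f n))
          ; ⁻¹-cong = λ f≋g → coeffwise λ n → -‿cong (coeff f≋g n)
          }
        ; comm = λ f g → coeffwise λ n → +-comm (f n) (g n)
        }
      ; *-cong     = ⊛-cong
      ; *-assoc    = ⊛-assoc
      ; *-identity = ⊛-identityˡ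
                   , (λ f → ≋-trans (⊛-comm f 𝟙) (⊛-identityˡ f))
      ; distrib    = (λ f g h → ⊛-distribˡ f g h) , (λ f g h → ⊛-distribʳ f g h)
      }
    ; *-comm = ⊛-comm
    }
    where open IsEquivalence ≋-isEquivalence using () renaming (trans to ≋-trans)

  powerSeriesRing : CommutativeRing c ℓ
  powerSeriesRing = record { isCommutativeRing = ⊛-isCommutativeRing }

  module ∑Series = SumUpTo (CommutativeRing.semiring powerSeriesRing)

  sumUpTo-coeff : ∀ h (fs : ℕ → Series) n → ∑Series.sumUpTo h fs n ≈ sumUpTo h (λ d → fs d n)
  sumUpTo-coeff zero    fs n = refl
  sumUpTo-coeff (suc h) fs n = +-congˡ (sumUpTo-coeff h (λ d → fs (suc d)) n)

  open import Algebra.Definitions.RawSemiring (Semiring.rawSemiring (CommutativeRing.semiring powerSeriesRing))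
    using (_^_) public

  ^-vanish : ∀ {D} → D 0 ≈ 0# → ∀ k n → n < k → (D ^ k) n ≈ 0#
  ^-vanish {D} D₀≈0 (suc k) n (s≤s n≤k) = sumUpTo-zero (suc n) vanish
    where
    vanish : ∀ j → j < suc n → D j * (D ^ k) (n ∸ j) ≈ 0#
    vanish zero    _         = trans (*-congʳ D₀≈0) (zeroˡ _)
    vanish (suc j) (s≤s j<n) =
      trans (*-congˡ (^-vanish D₀≈0 k (n ∸ suc j) (≤-trans (∸-monoʳ-< (s≤s z≤n) j<n) n≤k))) (zeroʳ _)

  geometricSeries : Series → Series
  geometricSeries D n = sumUpTo (suc n) (λ k → (D ^ k) n)

  geometricSeries-unfold : ∀ {D} → D 0 ≈ 0# → geometricSeries D ≋ 𝟙 ⊕ D ⊛ geometricSeries D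
  geometricSeries-unfold {D} D₀≈0 = coeffwise λ n → +-congˡ (sym (D⊛W n))
    where
    W = geometricSeries D
    D⊛W : ∀ n → (D ⊛ W) n ≈ sumUpTo n (λ k → (D ^ suc k) n)
    D⊛W n = begin
      sumUpTo (suc n) (λ j → D j * W (n ∸ j))
        ≈⟨ sumUpTo-cong< (suc n) (λ j _ → *-congˡ {D j} (sym (sumUpTo-extend (λ k → (D ^ k) (n ∸ j))
             (s≤s (m∸n≤m n j)) (λ k n-j<k _ → ^-vanish D₀≈0 k (n ∸ j) n-j<k)))) ⟩
      sumUpTo (suc n) (λ j → D j * sumUpTo (suc n) (λ k → (D ^ k) (n ∸ j)))
        ≈⟨ sumUpTo-cong (suc n) (λ j → sumUpTo-*ˡ (suc n) (D j) (λ k → (D ^ k) (n ∸ j))) ⟩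
      sumUpTo (suc n) (λ j → sumUpTo (suc n) (λ k → D j * (D ^ k) (n ∸ j)))
        ≈⟨ sumUpTo-comm (suc n) (suc n) (λ j k → D j * (D ^ k) (n ∸ j)) ⟩
      sumUpTo (suc n) (λ k → (D ^ suc k) n)
        ≈⟨ sumUpTo-extend (λ k → (D ^ suc k) n) (n≤1+n n) (λ k n≤k _ → ^-vanish D₀≈0 (suc k) n (s≤s n≤k)) ⟩
      sumUpTo n (λ k → (D ^ suc k) n)
        ∎

module Staircase {c ℓ} (R : CommutativeRing c ℓ) where

  open CommutativeRing R
  open SumUpTo semiring
  open import Algebra.Properties.CommutativeSemigroup *-commutativeSemigroup using (x∙yz≈y∙xz)
  open import Algebra.Properties.CommutativeSemigroup +-commutativeSemigroup using (xy∙z≈xz∙y)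
  open import Algebra.Properties.Group +-group using (∙-cancelʳ)
  open import Relation.Binary.Reasoning.Setoid setoid

  Staircase : (ℕ → Carrier) → (ℕ → Carrier) → Set ℓ
  Staircase m T = ∀ h → T h ≈ 1# + sumUpTo h (λ d → m d * T d) + m h * T (suc h)

  module ProductTransform
    (m F D : ℕ → Carrier)
    (F-rec : ∀ h → F h ≈ 1# + m h * F (suc h) + sumUpTo (suc h) (λ y → m y * D y))
    (D-rec : ∀ h → D h ≈ m h * F (suc h))
    where

    prefixProduct : ℕ → Carrier
    prefixProduct zero    = 1#
    prefixProduct (suc h) = prefixProduct h * (1# + m h)

    private
      P : ℕ → Carrier
      P = prefixProduct
      u : ℕ → Carrier
      u h = P h * F h
      Z : ℕ → Carrier
      Z h = 1# + sumUpTo h (λ y → m y * D y)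
      K : ℕ → Carrier
      K h = m h * F (suc h)

    Z-suc : ∀ h → Z (suc h) ≈ Z h + m h * K h
    Z-suc h = begin
      1# + sumUpTo (suc h) (λ y → m y * D y)          ≈⟨ +-congˡ (sumUpTo-suc h (λ y → m y * D y)) ⟩
      1# + (sumUpTo h (λ y → m y * D y) + m h * D h)  ≈⟨ +-assoc _ _ _ ⟨
      Z h + m h * D h                                 ≈⟨ +-congˡ (*-congˡ (D-rec h)) ⟩
      Z h + m h * K h                                 ∎

    F≈Z+K : ∀ h → F h ≈ Z (suc h) + K h
    F≈Z+K h = trans (F-rec h) (xy∙z≈xz∙y 1# (K h) _)

    one+m*K : ∀ h → (1# + m h) * K h ≈ m h * K h + K h
    one+m*K h = trans (distribʳ (K h) 1# (m h)) (trans (+-congʳ (*-identityˡ (K h))) (+-comm _ _))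

    u≈PZ+m*u : ∀ h → u h ≈ P h * Z h + m h * u (suc h)
    u≈PZ+m*u h = begin
      P h * F h                                           ≈⟨ *-congˡ (F≈Z+K h) ⟩
      P h * (Z (suc h) + K h)                             ≈⟨ *-congˡ (+-congʳ (Z-suc h)) ⟩
      P h * (Z h + m h * K h + K h)                       ≈⟨ *-congˡ (+-assoc _ _ _) ⟩
      P h * (Z h + (m h * K h + K h))                     ≈⟨ distribˡ (P h) (Z h) _ ⟩
      P h * Z h + P h * (m h * K h + K h)                 ≈⟨ +-congˡ (*-congˡ (one+m*K h)) ⟨
      P h * Z h + P h * ((1# + m h) * K h)                ≈⟨ +-congˡ (*-congˡ (x∙yz≈y∙xz (1# + m h) (m h) _)) ⟩
      P h * Z h + P h * (m h * ((1# + m h) * F (suc h)))  ≈⟨ +-congˡ (x∙yz≈y∙xz (P h) (m h) _) ⟩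
      P h * Z h + m h * (P h * ((1# + m h) * F (suc h)))  ≈⟨ +-congˡ (*-congˡ (*-assoc _ _ _)) ⟨
      P h * Z h + m h * u (suc h)                         ∎

    PZ≈1+∑m*u : ∀ h → P h * Z h ≈ 1# + sumUpTo h (λ d → m d * u d)
    PZ≈1+∑m*u zero    = *-identityˡ _
    PZ≈1+∑m*u (suc h) = begin
      P h * (1# + m h) * Z′                            ≈⟨ *-assoc _ _ _ ⟩
      P h * ((1# + m h) * Z′)                          ≈⟨ *-congˡ (distribʳ Z′ 1# (m h)) ⟩
      P h * (1# * Z′ + m h * Z′)                       ≈⟨ distribˡ (P h) _ _ ⟩
      P h * (1# * Z′) + P h * (m h * Z′)               ≈⟨ +-cong (*-congˡ (*-identityˡ _)) (x∙yz≈y∙xz (P h) (m h) _) ⟩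
      P h * Z′ + m h * (P h * Z′)                      ≈⟨ +-congʳ (*-congˡ (Z-suc h)) ⟩
      P h * (Z h + m h * K h) + m h * (P h * Z′)       ≈⟨ +-congʳ (distribˡ (P h) (Z h) _) ⟩
      P h * Z h + P h * (m h * K h) + m h * (P h * Z′) ≈⟨ +-assoc _ _ _ ⟩
      P h * Z h + (P h * (m h * K h) + m h * (P h * Z′)) ≈⟨ +-cong (PZ≈1+∑m*u h) (+-comm _ _) ⟩
      1# + S + (m h * (P h * Z′) + P h * (m h * K h))  ≈⟨ +-congˡ m*u≈ ⟨
      1# + S + m h * u h                               ≈⟨ +-assoc _ _ _ ⟩
      1# + (S + m h * u h)                             ≈⟨ +-congˡ (sumUpTo-suc h (λ d → m d * u d)) ⟨
      1# + sumUpTo (suc h) (λ d → m d * u d)           ∎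
      where
      Z′ = Z (suc h)
      S  = sumUpTo h (λ d → m d * u d)
      m*u≈ : m h * u h ≈ m h * (P h * Z′) + P h * (m h * K h)
      m*u≈ = begin
        m h * (P h * F h)                            ≈⟨ *-congˡ (*-congˡ (F≈Z+K h)) ⟩
        m h * (P h * (Z′ + K h))                     ≈⟨ *-congˡ (distribˡ (P h) _ _) ⟩
        m h * (P h * Z′ + P h * K h)                 ≈⟨ distribˡ (m h) _ _ ⟩
        m h * (P h * Z′) + m h * (P h * K h)         ≈⟨ +-congˡ (x∙yz≈y∙xz (m h) (P h) (K h)) ⟩
        m h * (P h * Z′) + P h * (m h * K h)         ∎

    staircase-prefixProduct : Staircase m (λ h → prefixProduct h * F h)
    staircase-prefixProduct h = trans (u≈PZ+m*u h) (+-congʳ (PZ≈1+∑m*u h))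

  module GeometricTransform
    (x W : Carrier) (c α G : ℕ → Carrier)
    (G-rec : ∀ h → G h ≈ c h * α h + G (suc h))
    (α-rec : ∀ h → α h + x * G h ≈ 1# + x * c h * α (suc h))
    (W-rec : W ≈ 1# + x * G 0 * W)
    where

    private
      m v E : ℕ → Carrier
      m h = x * c h
      v h = W * α h
      E h = x * G h * W

    G₀-telescope : ∀ h → G 0 ≈ sumUpTo h (λ d → c d * α d) + G h
    G₀-telescope zero    = sym (+-identityˡ (G 0))
    G₀-telescope (suc h) = begin
      G 0                                                         ≈⟨ G₀-telescope h ⟩
      sumUpTo h (λ d → c d * α d) + G h                           ≈⟨ +-congˡ (G-rec h) ⟩
      sumUpTo h (λ d → c d * α d) + (c h * α h + G (suc h))       ≈⟨ +-assoc _ _ _ ⟨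
      sumUpTo h (λ d → c d * α d) + c h * α h + G (suc h)         ≈⟨ +-congʳ (sumUpTo-suc h (λ d → c d * α d)) ⟨
      sumUpTo (suc h) (λ d → c d * α d) + G (suc h)               ∎

    x*∑*W : ∀ h → x * sumUpTo h (λ d → c d * α d) * W ≈ sumUpTo h (λ d → m d * v d)
    x*∑*W h = begin
      x * sumUpTo h (λ d → c d * α d) * W       ≈⟨ *-comm _ W ⟩
      W * (x * sumUpTo h (λ d → c d * α d))     ≈⟨ *-congˡ (sumUpTo-*ˡ h x (λ d → c d * α d)) ⟩
      W * sumUpTo h (λ d → x * (c d * α d))     ≈⟨ sumUpTo-*ˡ h W (λ d → x * (c d * α d)) ⟩
      sumUpTo h (λ d → W * (x * (c d * α d)))   ≈⟨ sumUpTo-cong h (λ d → rearrange (c d) (α d)) ⟩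
      sumUpTo h (λ d → m d * v d)               ∎
      where
      rearrange : ∀ a b → W * (x * (a * b)) ≈ x * a * (W * b)
      rearrange a b = begin
        W * (x * (a * b))  ≈⟨ *-congˡ (*-assoc x a b) ⟨
        W * (x * a * b)    ≈⟨ x∙yz≈y∙xz W (x * a) b ⟩
        x * a * (W * b)    ∎

    W-expand : ∀ h → W ≈ 1# + sumUpTo h (λ d → m d * v d) + E h
    W-expand h = begin
      W                                                   ≈⟨ W-rec ⟩
      1# + x * G 0 * W                                    ≈⟨ +-congˡ (*-congʳ (*-congˡ (G₀-telescope h))) ⟩
      1# + x * (S + G h) * W                              ≈⟨ +-congˡ (*-congʳ (distribˡ x S (G h))) ⟩
      1# + (x * S + x * G h) * W                          ≈⟨ +-congˡ (distribʳ W (x * S) (x * G h)) ⟩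
      1# + (x * S * W + E h)                              ≈⟨ +-assoc _ _ _ ⟨
      1# + x * S * W + E h                                ≈⟨ +-congʳ (+-congˡ (x*∑*W h)) ⟩
      1# + sumUpTo h (λ d → m d * v d) + E h              ∎
      where S = sumUpTo h (λ d → c d * α d)

    staircase-W*α : Staircase m v
    staircase-W*α h = ∙-cancelʳ (E h) _ _ (begin
      W * α h + E h                                       ≈⟨ +-congˡ (*-comm _ W) ⟩
      W * α h + W * (x * G h)                             ≈⟨ distribˡ W (α h) _ ⟨
      W * (α h + x * G h)                                 ≈⟨ *-congˡ (α-rec h) ⟩
      W * (1# + m h * α (suc h))                          ≈⟨ distribˡ W 1# _ ⟩
      W * 1# + W * (m h * α (suc h))                      ≈⟨ +-cong (*-identityʳ W) (x∙yz≈y∙xz W (m h) _) ⟩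
      W + m h * v (suc h)                                 ≈⟨ +-congʳ (W-expand h) ⟩
      1# + S + E h + m h * v (suc h)                      ≈⟨ xy∙z≈xz∙y (1# + S) (E h) _ ⟩
      1# + S + m h * v (suc h) + E h                      ∎)
      where S = sumUpTo h (λ d → m d * v d)

module StaircaseUniqueness {c ℓ} (R : CommutativeRing c ℓ) where

  open CommutativeRing R
  open PowerSeries R
  private module Ser = CommutativeRing powerSeriesRing
  open Staircase powerSeriesRing using (Staircase)
  open import Relation.Binary.Reasoning.Setoid setoid

  module _ (m : ℕ → Series) (a : ℕ → Carrier) (m≋x*a : ∀ h → m h ≋ shift (const (a h))) where

    m⊛-zero : ∀ h f → (m h ⊛ f) 0 ≈ 0#
    m⊛-zero h f = trans (coeff (Ser.*-congʳ {f} (m≋x*a h)) 0) (coeff (shift-⊛ (const (a h)) f) 0)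

    m⊛-suc : ∀ h f n → (m h ⊛ f) (suc n) ≈ a h * f n
    m⊛-suc h f n = begin
      (m h ⊛ f) (suc n)                  ≈⟨ coeff (Ser.*-congʳ {f} (m≋x*a h)) (suc n) ⟩
      (shift (const (a h)) ⊛ f) (suc n)  ≈⟨ coeff (shift-⊛ (const (a h)) f) (suc n) ⟩
      (const (a h) ⊛ f) n                ≈⟨ coeff (const-⊛ (a h) f) n ⟩
      a h * f n                          ∎

    staircase-coeff-zero : ∀ {T} → Staircase m T → ∀ h → T h 0 ≈ 1# + 0# + 0#
    staircase-coeff-zero {T} T-rec h = begin
      T h 0                                                          ≈⟨ coeff (T-rec h) 0 ⟩
      1# + ∑Series.sumUpTo h (λ d → m d ⊛ T d) 0 + (m h ⊛ T (suc h)) 0  ≈⟨ +-cong (+-congˡ ∑≈0) (m⊛-zero h (T (suc h))) ⟩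
      1# + 0# + 0#                                                   ∎
      where
      ∑≈0 = trans (sumUpTo-coeff h (λ d → m d ⊛ T d) 0) (sumUpTo-zero h (λ d _ → m⊛-zero d (T d)))

    staircase-coeff-suc : ∀ {T} → Staircase m T → ∀ h n →
      T h (suc n) ≈ 0# + sumUpTo h (λ d → a d * T d n) + a h * T (suc h) n
    staircase-coeff-suc {T} T-rec h n = begin
      T h (suc n)
        ≈⟨ coeff (T-rec h) (suc n) ⟩
      0# + ∑Series.sumUpTo h (λ d → m d ⊛ T d) (suc n) + (m h ⊛ T (suc h)) (suc n)
        ≈⟨ +-cong (+-congˡ ∑≈) (m⊛-suc h (T (suc h)) n) ⟩
      0# + sumUpTo h (λ d → a d * T d n) + a h * T (suc h) n
        ∎
      where
      ∑≈ = trans (sumUpTo-coeff h (λ d → m d ⊛ T d) (suc n)) (sumUpTo-cong h (λ d → m⊛-suc d (T d) n))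

    staircase-unique : ∀ {T T′} → Staircase m T → Staircase m T′ → ∀ h → T h ≋ T′ h
    staircase-unique {T} {T′} T-rec T′-rec h = coeffwise λ n → agree n h
      where
      agree : ∀ n h → T h n ≈ T′ h n
      agree zero    h = trans (staircase-coeff-zero T-rec h) (sym (staircase-coeff-zero T′-rec h))
      agree (suc n) h = begin
        T h (suc n)
          ≈⟨ staircase-coeff-suc T-rec h n ⟩
        0# + sumUpTo h (λ d → a d * T d n) + a h * T (suc h) n
          ≈⟨ +-cong (+-congˡ (sumUpTo-cong h λ d → *-congˡ {a d} (agree n d))) (*-congˡ (agree n (suc h))) ⟩
        0# + sumUpTo h (λ d → a d * T′ d n) + a h * T′ (suc h) n
          ≈⟨ staircase-coeff-suc T′-rec h n ⟨
        T′ h (suc n)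
          ∎

module Words where

  open import Data.Bool using (Bool; true; false; _∧_; not; if_then_else_)
  open import Data.Bool.Properties using (∧-zeroʳ; ∧-assoc) renaming (_≟_ to _≟ᵇ_)
  open import Data.Nat using (ℕ; zero; suc; _+_; _∸_; _≤_; _<_; _⊓_; _⊔_; _≤ᵇ_; _≡ᵇ_; z≤n; s≤s; s≤s⁻¹)
  import Data.Nat.Properties as ℕ
  open import Data.List using (List; []; _∷_; _++_; length; map; filter; concatMap; foldr; upTo; applyUpTo; zip)
  open import Data.List.Properties using (map-upTo; map-++; map-∘)
  open import Data.List.Relation.Unary.All as All using (All; []; _∷_)
  open import Data.Product using (_×_; _,_; proj₁; proj₂)
  import Data.Integer as ℤ
  open import Relation.Nullary using (does)
  open import Relation.Nullary.Decidable using (dec-true; dec-false)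
  open import Relation.Binary.Definitions using (tri<; tri≈; tri>)
  open import Relation.Unary using (Pred; Decidable)
  open import Relation.Binary.PropositionalEquality using (_≡_; _≢_; refl; cong; cong₂; sym; trans)
  open import Function using (_∘_)

  module ℕ∑ = SumUpTo ℕ.+-*-semiring
  open ℕ∑ using (sumUpTo)

  indicator : Bool → ℕ
  indicator b = if b then 1 else 0

  count : ∀ {a} {A : Set a} → (A → Bool) → List A → ℕ
  count p []       = 0
  count p (x ∷ xs) = indicator (p x) + count p xs

  module _ {a} {A : Set a} where

    length-filter≡count : ∀ {ℓ} {P : Pred A ℓ} (P? : Decidable P) xs →
                          length (filter P? xs) ≡ count (does ∘ P?) xs
    length-filter≡count P? []       = refl
    length-filter≡count P? (x ∷ xs) with does (P? x)
    ... | true  = cong suc (length-filter≡count P? xs)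
    ... | false = length-filter≡count P? xs

    count-cong : ∀ {p q : A → Bool} xs → (∀ x → p x ≡ q x) → count p xs ≡ count q xs
    count-cong []       p≗q = refl
    count-cong (x ∷ xs) p≗q = cong₂ _+_ (cong indicator (p≗q x)) (count-cong xs p≗q)

    count-false : ∀ {p : A → Bool} xs → (∀ x → p x ≡ false) → count p xs ≡ 0
    count-false []       p≗false = refl
    count-false (x ∷ xs) p≗false rewrite p≗false x = count-false xs p≗false

    count-++ : ∀ (p : A → Bool) xs ys → count p (xs ++ ys) ≡ count p xs + count p ys
    count-++ p []       ys = refl
    count-++ p (x ∷ xs) ys = trans (cong (indicator (p x) +_) (count-++ p xs ys))
                                   (sym (ℕ.+-assoc (indicator (p x)) (count p xs) (count p ys)))

    count-if : ∀ b (p : A → Bool) xs → count (λ x → b ∧ p x) xs ≡ (if b then count p xs else 0)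
    count-if true  p xs = refl
    count-if false p xs = count-false xs (λ _ → refl)

  count-map : ∀ {a b} {A : Set a} {B : Set b} (p : B → Bool) (f : A → B) xs →
              count p (map f xs) ≡ count (p ∘ f) xs
  count-map p f []       = refl
  count-map p f (x ∷ xs) = cong (indicator (p (f x)) +_) (count-map p f xs)

  count-concatMap-applyUpTo : ∀ {a b} {A : Set a} {B : Set b} (p : B → Bool) (f : A → List B) g n →
    count p (concatMap f (applyUpTo g n)) ≡ sumUpTo n (λ k → count p (f (g k)))
  count-concatMap-applyUpTo p f g zero    = refl
  count-concatMap-applyUpTo p f g (suc n) = trans (count-++ p (f (g 0)) _)
    (cong (count p (f (g 0)) +_) (count-concatMap-applyUpTo p f (g ∘ suc) n))

  count-applyUpTo : ∀ {a} {A : Set a} (p : A → Bool) g n →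
    count p (applyUpTo g n) ≡ sumUpTo n (λ k → indicator (p (g k)))
  count-applyUpTo p g zero    = refl
  count-applyUpTo p g (suc n) = cong (indicator (p (g 0)) +_) (count-applyUpTo p (g ∘ suc) n)

  count-upTo-suc : ∀ (p : ℕ → Bool) n → count p (upTo (suc n)) ≡ indicator (p 0) + count (p ∘ suc) (upTo n)
  count-upTo-suc p n = cong (indicator (p 0) +_)
    (trans (cong (count p) (sym (map-upTo suc n))) (count-map p suc (upTo n)))

  indicator≤1 : ∀ b → indicator b ≤ 1
  indicator≤1 true  = s≤s z≤n
  indicator≤1 false = z≤n

  does-≟true : ∀ b → does (b ≟ᵇ true) ≡ b
  does-≟true true  = refl
  does-≟true false = refl

  isFour : ℕ → ℕ
  isFour n = indicator (n ≡ᵇ 4)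

  isFour<4 : ∀ {n} → n < 4 → isFour n ≡ 0
  isFour<4 {n} n<4 = cong indicator (dec-false (n ℕ.≟ 4) (ℕ.<⇒≢ n<4))

  adjacentMinSum : List ℕ → ℕ
  adjacentMinSum (a ∷ b ∷ w) = a ⊓ b + adjacentMinSum (b ∷ w)
  adjacentMinSum _           = 0

  column : ℕ × ℕ → List (ℕ × ℕ)
  column p = map (λ r → (proj₁ p , r)) (upTo (suc (proj₂ p)))

  shiftCell : ℕ × ℕ → ℕ × ℕ
  shiftCell (c , r) = (suc c , r)

  cells-cons : ∀ v w → cells (v ∷ w) ≡ column (0 , v) ++ map shiftCell (cells w)
  cells-cons v w = cong (column (0 , v) ++_) (shifted (λ k → k) (length w) w)
    where
    shifted : ∀ g L w → concatMap column (zip (applyUpTo (suc ∘ g) L) w)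
                        ≡ map shiftCell (concatMap column (zip (applyUpTo g L) w))
    shifted g zero    w       = refl
    shifted g (suc L) []      = refl
    shifted g (suc L) (v ∷ w) = trans (cong₂ _++_ (map-∘ (upTo (suc v))) (shifted (g ∘ suc) L w))
                                      (sym (map-++ shiftCell (column (g 0 , v)) _))

  pointCount : List ℕ → ℕ → ℕ → ℕ
  pointCount w x y = count (pointInCell (x , y)) (cells w)

  rowContains : ℕ → ℕ → Bool
  rowContains y r = (r ≤ᵇ y) ∧ (y ≤ᵇ suc r)

  columnCount : ℕ → ℕ → ℕ
  columnCount v y = count (rowContains y) (upTo (suc v))

  pointCount-cons : ∀ v w x y → pointCount (v ∷ w) x y
    ≡ count (λ r → pointInCell (x , y) (0 , r)) (upTo (suc v)) + count (pointInCell (x , y) ∘ shiftCell) (cells w)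
  pointCount-cons v w x y = trans (cong (count (pointInCell (x , y))) (cells-cons v w))
    (trans (count-++ (pointInCell (x , y)) (column (0 , v)) _)
           (cong₂ _+_ (count-map _ _ (upTo (suc v))) (count-map _ shiftCell (cells w))))

  pointCount-zero : ∀ v w y → pointCount (v ∷ w) 0 y ≡ columnCount v y
  pointCount-zero v w y = trans (pointCount-cons v w 0 y)
    (trans (cong (columnCount v y +_) (count-false (cells w) (λ _ → refl))) (ℕ.+-identityʳ _))

  pointInCell-shift : ∀ x y c → pointInCell (suc x , y) (shiftCell c) ≡ pointInCell (x , y) c
  pointInCell-shift x y (c , r) rewrite ≤ᵇ-suc c x | ≤ᵇ-suc x (suc c) = refl

  pointCount-one : ∀ v w y → pointCount (v ∷ w) 1 y ≡ columnCount v y + pointCount w 0 y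
  pointCount-one v w y = trans (pointCount-cons v w 1 y)
    (cong (columnCount v y +_) (count-cong (cells w) (pointInCell-shift 0 y)))

  pointCount-suc-suc : ∀ v w x y → pointCount (v ∷ w) (suc (suc x)) y ≡ pointCount w (suc x) y
  pointCount-suc-suc v w x y = trans (pointCount-cons v w (suc (suc x)) y)
    (cong₂ _+_ (count-false (upTo (suc v)) (λ _ → refl)) (count-cong (cells w) (pointInCell-shift (suc x) y)))

  columnCount-zero : ∀ v → columnCount v 0 ≡ 1
  columnCount-zero v = trans (count-upTo-suc (rowContains 0) v) (cong suc (count-false (upTo v) (λ _ → refl)))

  columnCount-suc : ∀ v y → columnCount (suc v) (suc y) ≡ indicator (suc y ≤ᵇ 1) + columnCount v y
  columnCount-suc v y = trans (count-upTo-suc (rowContains (suc y)) (suc v))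
    (cong (indicator (suc y ≤ᵇ 1) +_) (count-cong (upTo (suc v)) λ r → cong₂ _∧_ (≤ᵇ-suc r y) (≤ᵇ-suc y (suc r))))

  columnCount-ground : ∀ y → columnCount 0 (suc y) ≤ 1
  columnCount-ground y = ℕ.≤-trans (ℕ.≤-reflexive (ℕ.+-identityʳ _)) (indicator≤1 (suc y ≤ᵇ 1))

  columnCount≤2 : ∀ v y → columnCount v y ≤ 2
  columnCount≤2 v       zero          = ℕ.≤-trans (ℕ.≤-reflexive (columnCount-zero v)) (s≤s z≤n)
  columnCount≤2 zero    (suc y)       = ℕ.≤-trans (columnCount-ground y) (s≤s z≤n)
  columnCount≤2 (suc v) (suc zero)    = ℕ.≤-reflexive (trans (columnCount-suc v 0) (cong suc (columnCount-zero v)))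
  columnCount≤2 (suc v) (suc (suc y)) = ℕ.≤-trans (ℕ.≤-reflexive (columnCount-suc v (suc y))) (columnCount≤2 v (suc y))

  fourCellHeights : ∀ a b Y → a ⊓ b ≤ Y →
    sumUpTo Y (λ y → isFour (columnCount a (suc y) + columnCount b (suc y))) ≡ a ⊓ b
  fourCellHeights zero    b       Y _ = ℕ∑.sumUpTo-zero Y λ y _ →
    isFour<4 (s≤s (ℕ.+-mono-≤ (columnCount-ground y) (columnCount≤2 b (suc y))))
  fourCellHeights (suc a) zero    Y _ = ℕ∑.sumUpTo-zero Y λ y _ →
    isFour<4 (s≤s (ℕ.≤-trans (ℕ.≤-reflexive (ℕ.+-comm (columnCount (suc a) (suc y)) (columnCount 0 (suc y))))
                             (ℕ.+-mono-≤ (columnCount-ground y) (columnCount≤2 (suc a) (suc y)))))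
  fourCellHeights (suc a) (suc b) (suc Y) (s≤s a⊓b≤Y) =
    cong₂ _+_ lowest (trans higher (fourCellHeights a b Y a⊓b≤Y))
    where
    lowest : isFour (columnCount (suc a) 1 + columnCount (suc b) 1) ≡ 1
    lowest = cong isFour
      (cong₂ _+_ (trans (columnCount-suc a 0) (cong suc (columnCount-zero a)))
                 (trans (columnCount-suc b 0) (cong suc (columnCount-zero b))))
    higher : sumUpTo Y (λ y → isFour (columnCount (suc a) (2 + y) + columnCount (suc b) (2 + y)))
           ≡ sumUpTo Y (λ y → isFour (columnCount a (suc y) + columnCount b (suc y)))
    higher = ℕ∑.sumUpTo-cong Y λ y →
      cong isFour (cong₂ _+_ (columnCount-suc a (suc y)) (columnCount-suc b (suc y)))

  noFourCells : ∀ {n} → n ≤ 2 → isFour n ≡ 0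
  noFourCells n≤2 = isFour<4 (s≤s (ℕ.≤-trans n≤2 (s≤s (s≤s z≤n))))

  fourCellPoints-leftBoundary : ∀ w Y → sumUpTo Y (λ y → isFour (pointCount w 0 y)) ≡ 0
  fourCellPoints-leftBoundary []      Y = ℕ∑.sumUpTo-zero Y λ _ _ → refl
  fourCellPoints-leftBoundary (v ∷ w) Y = ℕ∑.sumUpTo-zero Y λ y _ →
    noFourCells (ℕ.≤-trans (ℕ.≤-reflexive (pointCount-zero v w y)) (columnCount≤2 v y))

  interiorFourCellPoints : ∀ B w → All (_≤ B) w →
    sumUpTo (length w) (λ x → sumUpTo (suc (suc B)) (λ y → isFour (pointCount w (suc x) y)))
    ≡ adjacentMinSum w
  interiorFourCellPoints B []          _ = refl
  interiorFourCellPoints B (a ∷ [])    _ = cong (_+ 0) (ℕ∑.sumUpTo-zero (suc (suc B)) λ y _ →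
    noFourCells (ℕ.≤-trans (ℕ.≤-reflexive (trans (pointCount-one a [] y) (ℕ.+-identityʳ _))) (columnCount≤2 a y)))
  interiorFourCellPoints B (a ∷ b ∷ w) (a≤B ∷ b∷w≤B) = cong₂ _+_ firstGap
    (trans (ℕ∑.sumUpTo-cong (length (b ∷ w)) λ x → ℕ∑.sumUpTo-cong (suc (suc B)) λ y →
              cong isFour (pointCount-suc-suc a (b ∷ w) x y))
           (interiorFourCellPoints B (b ∷ w) b∷w≤B))
    where
    firstGap : sumUpTo (suc (suc B)) (λ y → isFour (pointCount (a ∷ b ∷ w) 1 y)) ≡ a ⊓ b
    firstGap = trans (ℕ∑.sumUpTo-cong (suc (suc B)) λ y → cong isFour
                       (trans (pointCount-one a (b ∷ w) y) (cong (columnCount a y +_) (pointCount-zero b w y))))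
               (cong₂ _+_ (cong isFour (cong₂ _+_ (columnCount-zero a) (columnCount-zero b)))
                          (fourCellHeights a b (suc B) (ℕ.≤-trans (ℕ.m⊓n≤m a b) (ℕ.m≤n⇒m≤1+n a≤B))))

  letters≤max : ∀ w → All (_≤ foldr _⊔_ 0 w) w
  letters≤max []      = []
  letters≤max (a ∷ w) = ℕ.m≤m⊔n a _ ∷ All.map (λ v≤ → ℕ.≤-trans v≤ (ℕ.m≤n⊔m a _)) (letters≤max w)

  cellsContaining≡pointCount : ∀ w x y → cellsContaining w (x , y) ≡ pointCount w x y
  cellsContaining≡pointCount w x y = trans (length-filter≡count _ (cells w))
    (count-cong (cells w) (does-≟true ∘ pointInCell (x , y)))

  inter≡adjacentMinSum : ∀ w → inter w ≡ adjacentMinSum w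
  inter≡adjacentMinSum w = begin
    inter w
      ≡⟨ length-filter≡count (λ p → cellsContaining w p ℕ.≟ 4) (candidatePoints w) ⟩
    count (λ p → cellsContaining w p ≡ᵇ 4) (candidatePoints w)
      ≡⟨ count-cong (candidatePoints w) (λ (x , y) → cong (_≡ᵇ 4) (cellsContaining≡pointCount w x y)) ⟩
    count fourCellPoint (candidatePoints w)
      ≡⟨ count-concatMap-applyUpTo fourCellPoint (λ x → map (x ,_) (upTo Y)) (λ x → x) (suc (length w)) ⟩
    sumUpTo (suc (length w)) (λ x → count fourCellPoint (map (x ,_) (upTo Y)))
      ≡⟨ ℕ∑.sumUpTo-cong (suc (length w)) (λ x → trans (count-map fourCellPoint (x ,_) (upTo Y))
                                                       (count-applyUpTo (λ y → fourCellPoint (x , y)) (λ y → y) Y)) ⟩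
    sumUpTo (suc (length w)) (λ x → sumUpTo Y (λ y → isFour (pointCount w x y)))
      ≡⟨ cong (_+ sumUpTo (length w) (λ x → sumUpTo Y (λ y → isFour (pointCount w (suc x) y))))
              (fourCellPoints-leftBoundary w Y) ⟩
    sumUpTo (length w) (λ x → sumUpTo Y (λ y → isFour (pointCount w (suc x) y)))
      ≡⟨ interiorFourCellPoints (foldr _⊔_ 0 w) w (letters≤max w) ⟩
    adjacentMinSum w
      ∎
    where
    open Relation.Binary.PropositionalEquality.≡-Reasoning
    Y = suc (suc (foldr _⊔_ 0 w))
    fourCellPoint : ℕ × ℕ → Bool
    fourCellPoint (x , y) = pointCount w x y ≡ᵇ 4

  data Step : Set where
    rise fall : Step

  -- accepts s h v: can v follow a letter h, reached by a step of kind s, in a word of 𝓑?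
  -- The first letter of a word counts as reached by a rise.
  accepts : Step → ℕ → List ℕ → Bool
  accepts rise h []       = true
  accepts fall h []       = false
  accepts rise h (y ∷ ys) = if y ≡ᵇ suc h then accepts rise y ys else (y ≤ᵇ h) ∧ accepts fall y ys
  accepts fall h (y ∷ ys) = (y ≡ᵇ suc h) ∧ accepts rise y ys

  stepKind : ℕ → ℕ → Step
  stepKind p h = if h ≤ᵇ p then fall else rise

  data NextLetter (h : ℕ) : ℕ → Set where
    up   : NextLetter h (suc h)
    down : ∀ {y} → y ≤ h → NextLetter h y
    jump : ∀ {y} → suc h < y → NextLetter h y

  nextLetter : ∀ h y → NextLetter h y
  nextLetter h y with ℕ.<-cmp y (suc h)
  ... | tri< y≤h _ _    = down (s≤s⁻¹ y≤h)
  ... | tri≈ _ refl _   = up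
  ... | tri> _ _ h+1<y  = jump h+1<y

  ≤ᵇ-true : ∀ {m n} → m ≤ n → (m ≤ᵇ n) ≡ true
  ≤ᵇ-true {m} {n} m≤n = dec-true (m ℕ.≤? n) m≤n

  ≤ᵇ-false : ∀ {m n} → n < m → (m ≤ᵇ n) ≡ false
  ≤ᵇ-false {m} {n} n<m = dec-false (m ℕ.≤? n) (ℕ.<⇒≱ n<m)

  ≡ᵇ-true : ∀ n → (n ≡ᵇ n) ≡ true
  ≡ᵇ-true n = dec-true (n ℕ.≟ n) refl

  ≡ᵇ-false : ∀ {m n} → m ≢ n → (m ≡ᵇ n) ≡ false
  ≡ᵇ-false {m} {n} m≢n = dec-false (m ℕ.≟ n) m≢n

  stepKind-up : ∀ h → stepKind h (suc h) ≡ rise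
  stepKind-up h = cong (if_then fall else rise) (≤ᵇ-false (ℕ.n<1+n h))

  stepKind-down : ∀ {h y} → y ≤ h → stepKind h y ≡ fall
  stepKind-down y≤h = cong (if_then fall else rise) (≤ᵇ-true y≤h)

  valid-suffix≡accepts : ∀ p h v →
    stepsOK h v ∧ (avoidsGeGe (p ∷ h ∷ v) ∧ not (endsWithWeakDescent (p ∷ h ∷ v))) ≡ accepts (stepKind p h) h v
  valid-suffix≡accepts p h [] with h ≤ᵇ p
  ... | true  = refl
  ... | false = refl
  valid-suffix≡accepts p h (y ∷ ys) with nextLetter h y | h ≤ᵇ p
  ... | up | true  rewrite ≤ᵇ-true (ℕ.≤-refl {suc h}) | ≤ᵇ-false (ℕ.n<1+n h) | ≡ᵇ-true (suc h) =
    trans (valid-suffix≡accepts h (suc h) ys) (cong (λ s → accepts s (suc h) ys) (stepKind-up h))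
  ... | up | false rewrite ≤ᵇ-true (ℕ.≤-refl {suc h}) | ≤ᵇ-false (ℕ.n<1+n h) | ≡ᵇ-true (suc h) =
    trans (valid-suffix≡accepts h (suc h) ys) (cong (λ s → accepts s (suc h) ys) (stepKind-up h))
  ... | down y≤h | true  rewrite ≤ᵇ-true (ℕ.m≤n⇒m≤1+n y≤h) | ≤ᵇ-true y≤h | ≡ᵇ-false (ℕ.<⇒≢ (s≤s y≤h)) =
    ∧-zeroʳ (stepsOK y ys)
  ... | down y≤h | false rewrite ≤ᵇ-true (ℕ.m≤n⇒m≤1+n y≤h) | ≤ᵇ-true y≤h | ≡ᵇ-false (ℕ.<⇒≢ (s≤s y≤h)) =
    trans (valid-suffix≡accepts h y ys) (cong (λ s → accepts s y ys) (stepKind-down y≤h))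
  ... | jump h+1<y | true  rewrite ≤ᵇ-false h+1<y | ≡ᵇ-false (ℕ.>⇒≢ h+1<y) = refl
  ... | jump h+1<y | false rewrite ≤ᵇ-false h+1<y | ≡ᵇ-false (ℕ.>⇒≢ h+1<y)
                              | ≤ᵇ-false (ℕ.<-trans (ℕ.n<1+n h) h+1<y) = refl

  inB-0∷≡accepts : ∀ v → inB (0 ∷ v) ≡ accepts rise 0 v
  inB-0∷≡accepts []       = refl
  inB-0∷≡accepts (y ∷ ys) = trans (∧-assoc (y ≤ᵇ 1) (stepsOK y ys) _)
    (trans (cong ((y ≤ᵇ 1) ∧_) (valid-suffix≡accepts 0 y ys)) (first-step y))
    where
    first-step : ∀ y → (y ≤ᵇ 1) ∧ accepts (stepKind 0 y) y ys ≡ accepts rise 0 (y ∷ ys)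
    first-step zero          = refl
    first-step (suc zero)    = refl
    first-step (suc (suc y)) = refl

  -- the coefficient of q^m in q^h f
  qShift : ℕ → (ℕ → ℕ) → ℕ → ℕ
  qShift h f m = if h ≤ᵇ m then f (m ∸ h) else 0

  -- The number of v of length n with accepts s h v and adjacentMinSum (h ∷ v) = m.
  acceptedCount : Step → ℕ → ℕ → ℕ → ℕ
  acceptedCount rise h zero    m = if m ≡ᵇ 0 then 1 else 0
  acceptedCount fall h zero    m = 0
  acceptedCount rise h (suc n) m =
    qShift h (acceptedCount rise (suc h) n) m + sumUpTo (suc h) (λ y → qShift y (acceptedCount fall y n) m)
  acceptedCount fall h (suc n) m = qShift h (acceptedCount rise (suc h) n) m

  +≡ᵇ : ∀ a t m → (a + t ≡ᵇ m) ≡ (a ≤ᵇ m) ∧ (t ≡ᵇ m ∸ a)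
  +≡ᵇ zero    t m       = refl
  +≡ᵇ (suc a) t zero    = refl
  +≡ᵇ (suc a) t (suc m) = trans (+≡ᵇ a t m) (cong (_∧ (t ≡ᵇ m ∸ a)) (sym (≤ᵇ-suc a m)))

  count-shifted : ∀ {a} {A : Set a} (P : A → Bool) (S : A → ℕ) d m xs →
    count (λ v → P v ∧ (d + S v ≡ᵇ m)) xs ≡ qShift d (λ m′ → count (λ v → P v ∧ (S v ≡ᵇ m′)) xs) m
  count-shifted P S d m xs =
    trans (count-cong xs λ v → trans (cong (P v ∧_) (+≡ᵇ d (S v) m)) (swap (P v) {d ≤ᵇ m} {S v ≡ᵇ m ∸ d}))
          (count-if (d ≤ᵇ m) (λ v → P v ∧ (S v ≡ᵇ m ∸ d)) xs)
    where
    swap : ∀ p {b c} → p ∧ (b ∧ c) ≡ b ∧ (p ∧ c)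
    swap true  = refl
    swap false {b} = sym (∧-zeroʳ b)

  count-wordsBelow : ∀ (p : List ℕ → Bool) n K →
    count p (wordsBelow (suc n) K) ≡ sumUpTo K (λ y → count (λ v → p (y ∷ v)) (wordsBelow n K))
  count-wordsBelow p n K = trans (count-concatMap-applyUpTo p (λ a → map (a ∷_) (wordsBelow n K)) (λ k → k) K)
    (ℕ∑.sumUpTo-cong K (λ y → count-map p (y ∷_) (wordsBelow n K)))

  acceptedCount-correct : ∀ s h n K m → h + n < K →
    count (λ v → accepts s h v ∧ (adjacentMinSum (h ∷ v) ≡ᵇ m)) (wordsBelow n K) ≡ acceptedCount s h n m
  acceptedCount-correct rise h zero    K zero    _     = refl
  acceptedCount-correct rise h zero    K (suc m) _     = refl
  acceptedCount-correct fall h zero    K m       _     = refl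
  acceptedCount-correct s    h (suc n) K m       h+n<K = begin
    count (λ v → accepts s h v ∧ (adjacentMinSum (h ∷ v) ≡ᵇ m)) (wordsBelow (suc n) K)
      ≡⟨ count-wordsBelow (λ v → accepts s h v ∧ (adjacentMinSum (h ∷ v) ≡ᵇ m)) n K ⟩
    sumUpTo K (term s)
      ≡⟨ ℕ∑.sumUpTo-extend (term s) h+2≤K (λ y h+2≤y _ → term-jump s h+2≤y) ⟩
    sumUpTo (suc (suc h)) (term s)
      ≡⟨ ℕ∑.sumUpTo-suc (suc h) (term s) ⟩
    sumUpTo (suc h) (term s) + term s (suc h)
      ≡⟨ cong₂ _+_ (ℕ∑.sumUpTo-cong< (suc h) (λ y y<h+1 → term-down s (s≤s⁻¹ y<h+1))) (term-up s) ⟩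
    sumUpTo (suc h) (downTerm s) + qShift h (acceptedCount rise (suc h) n) m
      ≡⟨ assemble s ⟩
    acceptedCount s h (suc n) m
      ∎
    where
    open Relation.Binary.PropositionalEquality.≡-Reasoning
    h+1+n<K : suc h + n < K
    h+1+n<K = ℕ.≤-trans (ℕ.≤-reflexive (cong suc (sym (ℕ.+-suc h n)))) h+n<K
    h+2≤K : suc (suc h) ≤ K
    h+2≤K = ℕ.≤-trans (s≤s (ℕ.m≤m+n (suc h) n)) h+1+n<K

    term : Step → ℕ → ℕ
    term s y = count (λ v → accepts s h (y ∷ v) ∧ (adjacentMinSum (h ∷ y ∷ v) ≡ᵇ m)) (wordsBelow n K)

    downTerm : Step → ℕ → ℕ
    downTerm rise y = qShift y (acceptedCount fall y n) m
    downTerm fall y = 0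

    term-up : ∀ s → term s (suc h) ≡ qShift h (acceptedCount rise (suc h) n) m
    term-up s = begin
      term s (suc h)
        ≡⟨ count-cong (wordsBelow n K) (λ v → cong₂ _∧_ (accepts-up s v)
             (cong (λ k → k + adjacentMinSum (suc h ∷ v) ≡ᵇ m) (ℕ.m≤n⇒m⊓n≡m (ℕ.n≤1+n h)))) ⟩
      count (λ v → accepts rise (suc h) v ∧ (h + adjacentMinSum (suc h ∷ v) ≡ᵇ m)) (wordsBelow n K)
        ≡⟨ count-shifted (accepts rise (suc h)) (λ v → adjacentMinSum (suc h ∷ v)) h m (wordsBelow n K) ⟩
      qShift h (λ m′ → count (λ v → accepts rise (suc h) v ∧ (adjacentMinSum (suc h ∷ v) ≡ᵇ m′)) (wordsBelow n K)) m
        ≡⟨ cong (λ k → if h ≤ᵇ m then k else 0) (acceptedCount-correct rise (suc h) n K (m ∸ h) h+1+n<K) ⟩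
      qShift h (acceptedCount rise (suc h) n) m
        ∎
      where
      accepts-up : ∀ s v → accepts s h (suc h ∷ v) ≡ accepts rise (suc h) v
      accepts-up rise v rewrite ≡ᵇ-true (suc h) = refl
      accepts-up fall v rewrite ≡ᵇ-true (suc h) = refl

    term-down : ∀ s {y} → y ≤ h → term s y ≡ downTerm s y
    term-down rise {y} y≤h = begin
      term rise y
        ≡⟨ count-cong (wordsBelow n K) (λ v → cong₂ _∧_ (accepts-down {v})
             (cong (λ k → k + adjacentMinSum (y ∷ v) ≡ᵇ m) (ℕ.m≥n⇒m⊓n≡n y≤h))) ⟩
      count (λ v → accepts fall y v ∧ (y + adjacentMinSum (y ∷ v) ≡ᵇ m)) (wordsBelow n K)
        ≡⟨ count-shifted (accepts fall y) (λ v → adjacentMinSum (y ∷ v)) y m (wordsBelow n K) ⟩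
      qShift y (λ m′ → count (λ v → accepts fall y v ∧ (adjacentMinSum (y ∷ v) ≡ᵇ m′)) (wordsBelow n K)) m
        ≡⟨ cong (λ k → if y ≤ᵇ m then k else 0) (acceptedCount-correct fall y n K (m ∸ y) y+n<K) ⟩
      qShift y (acceptedCount fall y n) m
        ∎
      where
      y+n<K : y + n < K
      y+n<K = ℕ.≤-<-trans (ℕ.+-monoˡ-≤ n y≤h) (ℕ.≤-<-trans (ℕ.+-monoʳ-≤ h (ℕ.n≤1+n n)) h+n<K)
      accepts-down : ∀ {v} → accepts rise h (y ∷ v) ≡ accepts fall y v
      accepts-down rewrite ≡ᵇ-false (ℕ.<⇒≢ (s≤s y≤h)) | ≤ᵇ-true y≤h = refl
    term-down fall {y} y≤h = count-false (wordsBelow n K) λ v →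
      cong (λ b → (b ∧ accepts rise y v) ∧ (adjacentMinSum (h ∷ y ∷ v) ≡ᵇ m)) (≡ᵇ-false (ℕ.<⇒≢ (s≤s y≤h)))

    term-jump : ∀ s {y} → suc (suc h) ≤ y → term s y ≡ 0
    term-jump s {y} h+1<y = count-false (wordsBelow n K) λ v → cong (_∧ (adjacentMinSum (h ∷ y ∷ v) ≡ᵇ m)) (rejects s)
      where
      rejects : ∀ s {v} → accepts s h (y ∷ v) ≡ false
      rejects rise rewrite ≡ᵇ-false (ℕ.>⇒≢ h+1<y) | ≤ᵇ-false (ℕ.<-trans (ℕ.n<1+n h) h+1<y) = refl
      rejects fall rewrite ≡ᵇ-false (ℕ.>⇒≢ h+1<y) = refl

    assemble : ∀ s → sumUpTo (suc h) (downTerm s) + qShift h (acceptedCount rise (suc h) n) m ≡ acceptedCount s h (suc n) m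
    assemble rise = ℕ.+-comm (sumUpTo (suc h) (downTerm rise)) _
    assemble fall = cong (_+ qShift h (acceptedCount rise (suc h) n) m) (ℕ∑.sumUpTo-zero (suc h) (λ _ _ → refl))

  Hcoeff-suc : ∀ n m → Hcoeff (suc n) m ≡ ℤ.+ acceptedCount rise 0 n m
  Hcoeff-suc n m = cong ℤ.+_ (begin
    length (filter (λ w → (inB w ∧ (inter w ≡ᵇ m)) ≟ᵇ true) (wordsBelow (suc n) (suc n)))
      ≡⟨ length-filter≡count (λ w → (inB w ∧ (inter w ≡ᵇ m)) ≟ᵇ true) (wordsBelow (suc n) (suc n)) ⟩
    count (λ w → does ((inB w ∧ (inter w ≡ᵇ m)) ≟ᵇ true)) (wordsBelow (suc n) (suc n))
      ≡⟨ count-cong (wordsBelow (suc n) (suc n)) (λ w →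
           trans (does-≟true _) (cong (λ k → inB w ∧ (k ≡ᵇ m)) (inter≡adjacentMinSum w))) ⟩
    count (λ w → inB w ∧ (adjacentMinSum w ≡ᵇ m)) (wordsBelow (suc n) (suc n))
      ≡⟨ count-wordsBelow (λ w → inB w ∧ (adjacentMinSum w ≡ᵇ m)) n (suc n) ⟩
    count (λ v → inB (0 ∷ v) ∧ (adjacentMinSum (0 ∷ v) ≡ᵇ m)) (wordsBelow n (suc n))
      + sumUpTo n (λ y → count (λ v → inB (suc y ∷ v) ∧ (adjacentMinSum (suc y ∷ v) ≡ᵇ m)) (wordsBelow n (suc n)))
      ≡⟨ cong₂ _+_ (count-cong (wordsBelow n (suc n)) (λ v → cong (_∧ (adjacentMinSum (0 ∷ v) ≡ᵇ m)) (inB-0∷≡accepts v)))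
                   (ℕ∑.sumUpTo-zero n (λ y _ → count-false (wordsBelow n (suc n)) (λ _ → refl))) ⟩
    count (λ v → accepts rise 0 v ∧ (adjacentMinSum (0 ∷ v) ≡ᵇ m)) (wordsBelow n (suc n)) + 0
      ≡⟨ ℕ.+-identityʳ _ ⟩
    count (λ v → accepts rise 0 v ∧ (adjacentMinSum (0 ∷ v) ≡ᵇ m)) (wordsBelow n (suc n))
      ≡⟨ acceptedCount-correct rise 0 n (suc n) m ℕ.≤-refl ⟩
    acceptedCount rise 0 n m
      ∎)
    where open Relation.Binary.PropositionalEquality.≡-Reasoning

module RightHandSide where

  open import Algebra.Bundles using (CommutativeRing)
  open import Data.Bool using (if_then_else_)
  open import Data.Nat using (ℕ; zero; suc; _+_; _*_; _∸_; _≤ᵇ_; _≤?_)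
  open import Data.Integer using (ℤ; +_) renaming (_+_ to _+ℤ_; _*_ to _*ℤ_)
  open import Data.Integer.Properties as ℤ using (+-*-commutativeRing)
  open import Data.Nat.Properties as ℕ using (m≤n⇒∃[o]m+o≡n; m+n∸m≡n)
  open import Data.List using ([]; _∷_; _∷ʳ_; foldr; map; upTo; applyUpTo)
  open import Data.List.Properties using (map-upTo; applyUpTo-∷ʳ; foldr-∷ʳ)
  open import Data.Nat.Divisibility using (_∣?_; ∣m+n∣m⇒∣n; ∣m∣n⇒∣m+n; ∣-refl; _∣0; ∣⇒≤)
  open import Data.Product using (_,_)
  open import Function.Bundles using (mk⇔)
  open import Relation.Nullary using (yes; no)
  open import Relation.Nullary.Decidable using (dec-true; dec-false; does-⇔)
  open import Relation.Binary.PropositionalEquality using (_≡_; refl; cong; sym; trans)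

  module Q = PowerSeries +-*-commutativeRing
  module X = PowerSeries Q.powerSeriesRing
  module QR = CommutativeRing Q.powerSeriesRing
  module XR = CommutativeRing X.powerSeriesRing

  foldr-+-upTo : ∀ (f : ℕ → ℤ) n → foldr _+ℤ_ (+ 0) (map f (upTo n)) ≡ Q.sumUpTo n f
  foldr-+-upTo f n = trans (cong (foldr _+ℤ_ (+ 0)) (map-upTo f n)) (go f n)
    where
    go : ∀ (f : ℕ → ℤ) n → foldr _+ℤ_ (+ 0) (applyUpTo f n) ≡ Q.sumUpTo n f
    go f zero    = refl
    go f (suc n) = cong (f 0 +ℤ_) (go (λ k → f (suc k)) n)

  *Q≋⊛ : ∀ f g → f *Q g Q.≋ f Q.⊛ g
  *Q≋⊛ f g = Q.coeffwise λ m → foldr-+-upTo (λ k → f k *ℤ g (m ∸ k)) (suc m)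

  *X≋⊛ : ∀ F G → F *X G X.≋ F X.⊛ G
  *X≋⊛ F G = X.coeffwise λ n → Q.coeffwise λ m → begin
    (F *X G) n m                                               ≡⟨ foldr-+-upTo (λ k → (F k *Q G (n ∸ k)) m) (suc n) ⟩
    Q.sumUpTo (suc n) (λ k → (F k *Q G (n ∸ k)) m)             ≡⟨ Q.sumUpTo-cong (suc n) (λ k → Q.coeff (*Q≋⊛ (F k) (G (n ∸ k))) m) ⟩
    Q.sumUpTo (suc n) (λ k → (F k Q.⊛ G (n ∸ k)) m)            ≡⟨ Q.sumUpTo-coeff (suc n) (λ k → F k Q.⊛ G (n ∸ k)) m ⟨
    (F X.⊛ G) n m                                              ∎
    where open Relation.Binary.PropositionalEquality.≡-Reasoning

  oneQ≋𝟙 : oneQ Q.≋ Q.𝟙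
  oneQ≋𝟙 = Q.coeffwise λ where
    zero    → refl
    (suc _) → refl

  oneX≋𝟙 : oneX X.≋ X.𝟙
  oneX≋𝟙 = X.coeffwise λ where
    zero    → oneQ≋𝟙
    (suc _) → QR.refl

  ^X≋^ : ∀ D k → D ^X k X.≋ D X.^ k
  ^X≋^ D zero    = oneX≋𝟙
  ^X≋^ D (suc k) = XR.trans (*X≋⊛ D (D ^X k)) (XR.*-congˡ {D} (^X≋^ D k))

  invOneMinusX≋geometricSeries : ∀ D → invOneMinusX D X.≋ X.geometricSeries D
  invOneMinusX≋geometricSeries D = X.coeffwise λ n → Q.coeffwise λ m → begin
    invOneMinusX D n m                                   ≡⟨ foldr-+-upTo (λ k → (D ^X k) n m) (suc n) ⟩
    Q.sumUpTo (suc n) (λ k → (D ^X k) n m)               ≡⟨ Q.sumUpTo-cong (suc n) (λ k → Q.coeff (X.coeff (^X≋^ D k) n) m) ⟩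
    Q.sumUpTo (suc n) (λ k → (D X.^ k) n m)              ≡⟨ Q.sumUpTo-coeff (suc n) (λ k → (D X.^ k) n) m ⟨
    X.geometricSeries D n m                              ∎
    where open Relation.Binary.PropositionalEquality.≡-Reasoning

  qpow-zero : qpow 0 Q.≋ Q.𝟙
  qpow-zero = Q.coeffwise λ where
    zero    → refl
    (suc _) → refl

  qpow-suc : ∀ k → qpow (suc k) Q.≋ Q.shift (qpow k)
  qpow-suc k = Q.coeffwise λ where
    zero    → refl
    (suc _) → refl

  qpow-+ : ∀ a b → qpow a Q.⊛ qpow b Q.≋ qpow (a + b)
  qpow-+ zero    b = QR.trans (QR.*-congʳ {qpow b} qpow-zero) (QR.*-identityˡ (qpow b))
  qpow-+ (suc a) b = begin
    qpow (suc a) Q.⊛ qpow b          ≈⟨ QR.*-congʳ {qpow b} (qpow-suc a) ⟩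
    Q.shift (qpow a) Q.⊛ qpow b      ≈⟨ Q.shift-⊛ (qpow a) (qpow b) ⟩
    Q.shift (qpow a Q.⊛ qpow b)      ≈⟨ Q.shift-cong (qpow-+ a b) ⟩
    Q.shift (qpow (a + b))           ≈⟨ qpow-suc (a + b) ⟨
    qpow (suc a + b)                 ∎
    where open import Relation.Binary.Reasoning.Setoid QR.setoid

  qpow-⊛ : ∀ h f m → (qpow h Q.⊛ f) m ≡ (if h ≤ᵇ m then f (m ∸ h) else + 0)
  qpow-⊛ zero    f m = Q.coeff (QR.trans (QR.*-congʳ {f} qpow-zero) (QR.*-identityˡ f)) m
  qpow-⊛ (suc h) f m = trans (Q.coeff (QR.trans (QR.*-congʳ {f} (qpow-suc h)) (Q.shift-⊛ (qpow h) f)) m) (shifted m)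
    where
    shifted : ∀ m → Q.shift (qpow h Q.⊛ f) m ≡ (if suc h ≤ᵇ m then f (m ∸ suc h) else + 0)
    shifted zero    = refl
    shifted (suc m) = trans (qpow-⊛ h f m) (cong (λ b → if b then f (m ∸ h) else + 0) (sym (≤ᵇ-suc h m)))

  invOneMinusQPow-unfold : ∀ k →
    invOneMinusQPow (suc k) Q.≋ Q.𝟙 Q.⊕ qpow (suc k) Q.⊛ invOneMinusQPow (suc k)
  invOneMinusQPow-unfold k = Q.coeffwise λ m → trans (coeff-at m) (cong (Q.𝟙 m +ℤ_) (sym (qpow-⊛ (suc k) I m)))
    where
    I = invOneMinusQPow (suc k)
    coeff-at : ∀ m → I m ≡ Q.𝟙 m +ℤ (if suc k ≤ᵇ m then I (m ∸ suc k) else + 0)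
    coeff-at m with suc k ≤? m
    ... | yes k<m with r , refl ← m≤n⇒∃[o]m+o≡n k<m
      rewrite dec-true (suc k ≤? suc k + r) k<m | m+n∸m≡n (suc k) r =
        trans (cong (λ b → if b then + 1 else + 0) (does-⇔ k∣k+r⇔k∣r (suc k ∣? suc k + r) (suc k ∣? r)))
              (sym (ℤ.+-identityˡ (I r)))
      where
      k∣k+r⇔k∣r = mk⇔ (λ k∣k+r → ∣m+n∣m⇒∣n k∣k+r ∣-refl) (∣m∣n⇒∣m+n ∣-refl)
    ... | no k≮m with m
    ...   | zero  rewrite dec-true (suc k ∣? 0) (suc k ∣0) = refl
    ...   | suc m rewrite dec-false (suc k ∣? suc m) (λ k∣m → k≮m (∣⇒≤ k∣m))
                        | dec-false (suc k ≤? suc m) k≮m = refl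

  foldr-*Q : ∀ xs y → foldr _*Q_ y xs Q.≋ foldr _*Q_ oneQ xs Q.⊛ y
  foldr-*Q []       y = QR.sym (QR.trans (QR.*-congʳ {y} oneQ≋𝟙) (QR.*-identityˡ y))
  foldr-*Q (x ∷ xs) y = begin
    x *Q foldr _*Q_ y xs                    ≈⟨ *Q≋⊛ x (foldr _*Q_ y xs) ⟩
    x Q.⊛ foldr _*Q_ y xs                   ≈⟨ QR.*-congˡ {x} (foldr-*Q xs y) ⟩
    x Q.⊛ (foldr _*Q_ oneQ xs Q.⊛ y)        ≈⟨ QR.*-assoc x (foldr _*Q_ oneQ xs) y ⟨
    x Q.⊛ foldr _*Q_ oneQ xs Q.⊛ y          ≈⟨ QR.*-congʳ {y} (*Q≋⊛ x (foldr _*Q_ oneQ xs)) ⟨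
    (x *Q foldr _*Q_ oneQ xs) Q.⊛ y         ∎
    where open import Relation.Binary.Reasoning.Setoid QR.setoid

  prodFactors-suc : ∀ n → prodFactors (suc (suc n)) Q.≋ prodFactors (suc n) Q.⊛ factor (suc n)
  prodFactors-suc n = begin
    foldr _*Q_ oneQ (map f (upTo (suc n)))               ≡⟨ cong (foldr _*Q_ oneQ) snoc ⟩
    foldr _*Q_ oneQ (applyUpTo f n ∷ʳ f n)               ≡⟨ foldr-∷ʳ _*Q_ oneQ (f n) (applyUpTo f n) ⟩
    foldr _*Q_ (f n *Q oneQ) (applyUpTo f n)             ≈⟨ foldr-*Q (applyUpTo f n) (f n *Q oneQ) ⟩
    foldr _*Q_ oneQ (applyUpTo f n) Q.⊛ (f n *Q oneQ)    ≈⟨ QR.*-cong (QR.reflexive (cong (foldr _*Q_ oneQ) (sym (map-upTo f n)))) fₙ*1≋fₙ ⟩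
    prodFactors (suc n) Q.⊛ f n                          ∎
    where
    open import Relation.Binary.Reasoning.Setoid QR.setoid
    f = λ i → factor (suc i)
    snoc : map f (upTo (suc n)) ≡ applyUpTo f n ∷ʳ f n
    snoc = trans (map-upTo f (suc n)) (sym (applyUpTo-∷ʳ f n))
    fₙ*1≋fₙ : f n *Q oneQ Q.≋ f n
    fₙ*1≋fₙ = QR.trans (*Q≋⊛ (f n) oneQ) (QR.trans (QR.*-congˡ {f n} oneQ≋𝟙) (QR.*-identityʳ (f n)))

  qpow-⊛-⊛ : ∀ a b f → qpow a Q.⊛ (qpow b Q.⊛ f) Q.≋ qpow (a + b) Q.⊛ f
  qpow-⊛-⊛ a b f = QR.trans (QR.sym (QR.*-assoc (qpow a) (qpow b) f)) (QR.*-congʳ {f} (qpow-+ a b))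

  -- With N the numerator and S the sum in the denominator of the right-hand side,
  -- α h = N(q^h x)/(q^h x) and G h = S(q^h x)/x.
  α : ℕ → XS
  α h n = qpow (n * h) Q.⊛ prodFactors (suc n)

  G : ℕ → XS
  G h n = invOneMinusQPow (suc n) Q.⊛ (qpow (suc n * h) Q.⊛ prodFactors (suc n))

  α-coeff-suc : ∀ h n → α h (suc n) Q.⊕ G h n Q.≋ qpow h Q.⊛ α (suc h) n
  α-coeff-suc h n = begin
    P ⊛ prodFactors (suc (suc n)) ⊕ I ⊛ (P ⊛ A)      ≈⟨ QR.+-congʳ (QR.*-congˡ {P} (prodFactors-suc n)) ⟩
    P ⊛ (A ⊛ (qpow n ⊕ ⊝ I)) ⊕ I ⊛ (P ⊛ A)           ≈⟨ QR.+-congʳ (QR.*-congˡ {P} (QR.distribˡ A (qpow n) (⊝ I))) ⟩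
    P ⊛ (A ⊛ qpow n ⊕ A ⊛ ⊝ I) ⊕ I ⊛ (P ⊛ A)         ≈⟨ QR.+-congʳ (QR.distribˡ P (A ⊛ qpow n) (A ⊛ ⊝ I)) ⟩
    P ⊛ (A ⊛ qpow n) ⊕ P ⊛ (A ⊛ ⊝ I) ⊕ I ⊛ (P ⊛ A)  ≈⟨ QR.+-assoc (P ⊛ (A ⊛ qpow n)) (P ⊛ (A ⊛ ⊝ I)) (I ⊛ (P ⊛ A)) ⟩
    P ⊛ (A ⊛ qpow n) ⊕ (P ⊛ (A ⊛ ⊝ I) ⊕ I ⊛ (P ⊛ A)) ≈⟨ QR.+-congˡ {P ⊛ (A ⊛ qpow n)} cancel ⟩
    P ⊛ (A ⊛ qpow n) ⊕ 𝟘                             ≈⟨ QR.+-identityʳ (P ⊛ (A ⊛ qpow n)) ⟩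
    P ⊛ (A ⊛ qpow n)                                  ≈⟨ QR.*-congˡ {P} (QR.*-comm A (qpow n)) ⟩
    P ⊛ (qpow n ⊛ A)                                  ≈⟨ qpow-⊛-⊛ (suc n * h) n A ⟩
    qpow (suc n * h + n) ⊛ A                          ≡⟨ cong (λ e → qpow e ⊛ A) exponent ⟩
    qpow (h + n * suc h) ⊛ A                          ≈⟨ qpow-⊛-⊛ h (n * suc h) A ⟨
    qpow h ⊛ α (suc h) n                              ∎
    where
    open Q using (_⊛_; _⊕_; ⊝_; 𝟘)
    open import Relation.Binary.Reasoning.Setoid QR.setoid
    open import Algebra.Properties.Ring QR.ring using (-‿distribʳ-*)
    P = qpow (suc n * h)
    A = prodFactors (suc n)
    I = invOneMinusQPow (suc n)
    cancel : P ⊛ (A ⊛ ⊝ I) ⊕ I ⊛ (P ⊛ A) Q.≋ 𝟘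
    cancel = begin
      P ⊛ (A ⊛ ⊝ I) ⊕ I ⊛ (P ⊛ A)      ≈⟨ QR.+-congʳ (QR.*-congˡ {P} (-‿distribʳ-* A I)) ⟨
      P ⊛ (⊝ (A ⊛ I)) ⊕ I ⊛ (P ⊛ A)    ≈⟨ QR.+-congʳ (-‿distribʳ-* P (A ⊛ I)) ⟨
      ⊝ (P ⊛ (A ⊛ I)) ⊕ I ⊛ (P ⊛ A)    ≈⟨ QR.+-congʳ (QR.-‿cong (QR.trans (QR.sym (QR.*-assoc P A I)) (QR.*-comm (P ⊛ A) I))) ⟩
      ⊝ (I ⊛ (P ⊛ A)) ⊕ I ⊛ (P ⊛ A)    ≈⟨ QR.-‿inverseˡ (I ⊛ (P ⊛ A)) ⟩
      𝟘                                 ∎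
    exponent : suc n * h + n ≡ h + n * suc h
    exponent = trans (ℕ.+-assoc h (n * h) n)
                     (cong (λ e → h + e) (trans (ℕ.+-comm (n * h) n) (sym (ℕ.*-suc n h))))

  G-coeff : ∀ h n → G h n Q.≋ qpow h Q.⊛ α h n Q.⊕ G (suc h) n
  G-coeff h n = begin
    I ⊛ (P ⊛ A)                                ≈⟨ QR.*-congʳ {P ⊛ A} (invOneMinusQPow-unfold n) ⟩
    (Q.𝟙 ⊕ qpow (suc n) ⊛ I) ⊛ (P ⊛ A)         ≈⟨ QR.distribʳ (P ⊛ A) Q.𝟙 (qpow (suc n) ⊛ I) ⟩
    Q.𝟙 ⊛ (P ⊛ A) ⊕ qpow (suc n) ⊛ I ⊛ (P ⊛ A) ≈⟨ QR.+-cong (QR.*-identityˡ (P ⊛ A)) shifted ⟩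
    P ⊛ A ⊕ I ⊛ (qpow (suc n * suc h) ⊛ A)     ≈⟨ QR.+-congʳ (qpow-⊛-⊛ h (n * h) A) ⟨
    qpow h ⊛ α h n ⊕ G (suc h) n               ∎
    where
    open Q using (_⊛_; _⊕_)
    open import Relation.Binary.Reasoning.Setoid QR.setoid
    open import Algebra.Properties.CommutativeSemigroup QR.*-commutativeSemigroup using (xy∙z≈y∙xz)
    P = qpow (suc n * h)
    A = prodFactors (suc n)
    I = invOneMinusQPow (suc n)
    shifted : qpow (suc n) ⊛ I ⊛ (P ⊛ A) Q.≋ I ⊛ (qpow (suc n * suc h) ⊛ A)
    shifted = begin
      qpow (suc n) ⊛ I ⊛ (P ⊛ A)               ≈⟨ xy∙z≈y∙xz (qpow (suc n)) I (P ⊛ A) ⟩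
      I ⊛ (qpow (suc n) ⊛ (P ⊛ A))             ≈⟨ QR.*-congˡ {I} (qpow-⊛-⊛ (suc n) (suc n * h) A) ⟩
      I ⊛ (qpow (suc n + suc n * h) ⊛ A)       ≡⟨ cong (λ e → I ⊛ (qpow e ⊛ A)) (sym (ℕ.*-suc (suc n) h)) ⟩
      I ⊛ (qpow (suc n * suc h) ⊛ A)           ∎

  x : XS
  x = X.shift X.𝟙

  monomial : ℕ → XS
  monomial h = x X.⊛ X.const (qpow h)

  x⊛ : ∀ F → x X.⊛ F X.≋ X.shift F
  x⊛ F = XR.trans (X.shift-⊛ X.𝟙 F) (X.shift-cong (XR.*-identityˡ F))

  monomial≋ : ∀ h → monomial h X.≋ X.shift (X.const (qpow h))
  monomial≋ h = x⊛ (X.const (qpow h))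

  open StaircaseUniqueness Q.powerSeriesRing using (m⊛-zero; m⊛-suc)

  α-rec : ∀ h → α h X.⊕ x X.⊛ G h X.≋ X.𝟙 X.⊕ monomial h X.⊛ α (suc h)
  α-rec h = X.coeffwise coeff-at
    where
    open import Relation.Binary.Reasoning.Setoid QR.setoid
    coeff-at : ∀ n → (α h X.⊕ x X.⊛ G h) n Q.≋ (X.𝟙 X.⊕ monomial h X.⊛ α (suc h)) n
    coeff-at zero = QR.+-cong
      (QR.trans (QR.*-congʳ {prodFactors 1} qpow-zero) (QR.trans (QR.*-identityˡ (prodFactors 1)) oneQ≋𝟙))
      (QR.trans (X.coeff (x⊛ (G h)) 0) (QR.sym (m⊛-zero monomial qpow monomial≋ h (α (suc h)))))
    coeff-at (suc n) = begin
      α h (suc n) Q.⊕ (x X.⊛ G h) (suc n)         ≈⟨ QR.+-congˡ {α h (suc n)} (X.coeff (x⊛ (G h)) (suc n)) ⟩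
      α h (suc n) Q.⊕ G h n                        ≈⟨ α-coeff-suc h n ⟩
      qpow h Q.⊛ α (suc h) n                       ≈⟨ m⊛-suc monomial qpow monomial≋ h (α (suc h)) n ⟨
      (monomial h X.⊛ α (suc h)) (suc n)           ≈⟨ QR.+-identityˡ _ ⟨
      Q.𝟘 Q.⊕ (monomial h X.⊛ α (suc h)) (suc n)   ∎

  G-rec : ∀ h → G h X.≋ X.const (qpow h) X.⊛ α h X.⊕ G (suc h)
  G-rec h = X.coeffwise λ n →
    QR.trans (G-coeff h n) (QR.+-congʳ {G (suc h) n} (QR.sym (X.coeff (X.const-⊛ (qpow h) (α h)) n)))

  qpow-n*0-⊛ : ∀ n f → qpow (n * 0) Q.⊛ f Q.≋ f
  qpow-n*0-⊛ n f = QR.trans (QR.*-congʳ {f} (QR.reflexive (cong qpow (ℕ.*-zeroʳ n))))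
                            (QR.trans (QR.*-congʳ {f} qpow-zero) (QR.*-identityˡ f))

  numer≋x⊛α₀ : numer X.≋ x X.⊛ α 0
  numer≋x⊛α₀ = XR.trans (X.coeffwise numer≋shift) (XR.sym (x⊛ (α 0)))
    where
    numer≋shift : ∀ n → numer n Q.≋ X.shift (α 0) n
    numer≋shift zero    = QR.refl
    numer≋shift (suc n) = QR.sym (qpow-n*0-⊛ n (prodFactors (suc n)))

  denomSum≋x⊛G₀ : denomSum X.≋ x X.⊛ G 0
  denomSum≋x⊛G₀ = XR.trans (X.coeffwise denomSum≋shift) (XR.sym (x⊛ (G 0)))
    where
    denomSum≋shift : ∀ n → denomSum n Q.≋ X.shift (G 0) n
    denomSum≋shift zero    = QR.refl
    denomSum≋shift (suc n) = QR.trans (*Q≋⊛ (invOneMinusQPow (suc n)) (prodFactors (suc n)))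
      (QR.*-congˡ {invOneMinusQPow (suc n)} (QR.sym (qpow-n*0-⊛ (suc n) (prodFactors (suc n)))))

  W : XS
  W = X.geometricSeries denomSum

  W-rec : W X.≋ X.𝟙 X.⊕ x X.⊛ G 0 X.⊛ W
  W-rec = XR.trans (X.geometricSeries-unfold {denomSum} QR.refl)
                   (XR.+-congˡ {X.𝟙} (XR.*-congʳ {W} denomSum≋x⊛G₀))

  open Staircase X.powerSeriesRing using (Staircase; module GeometricTransform)

  staircase-W⊛α : Staircase monomial (λ h → W X.⊛ α h)
  staircase-W⊛α = GeometricTransform.staircase-W*α x W (λ h → X.const (qpow h)) α G G-rec α-rec W-rec

  rhs≋shift-W⊛α₀ : rhs X.≋ X.shift (W X.⊛ α 0)
  rhs≋shift-W⊛α₀ = begin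
    numer *X invOneMinusX denomSum   ≈⟨ *X≋⊛ numer (invOneMinusX denomSum) ⟩
    numer X.⊛ invOneMinusX denomSum  ≈⟨ XR.*-cong numer≋x⊛α₀ (invOneMinusX≋geometricSeries denomSum) ⟩
    x X.⊛ α 0 X.⊛ W                   ≈⟨ XR.*-assoc x (α 0) W ⟩
    x X.⊛ (α 0 X.⊛ W)                 ≈⟨ x⊛ (α 0 X.⊛ W) ⟩
    X.shift (α 0 X.⊛ W)               ≈⟨ X.shift-cong (XR.*-comm (α 0) W) ⟩
    X.shift (W X.⊛ α 0)               ∎
    where open import Relation.Binary.Reasoning.Setoid XR.setoid

module LeftHandSide where

  open import Data.Bool.Properties using (if-float)
  open import Data.Nat using (ℕ; zero; suc; _≤ᵇ_)
  open import Data.Integer using (+_) renaming (_+_ to _+ℤ_)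
  import Data.Integer.Properties as ℤ
  open import Relation.Binary.PropositionalEquality using (_≡_; refl; cong; cong₂; sym; trans)
  open Words using (Step; rise; fall; acceptedCount; qShift; module ℕ∑)
  open RightHandSide

  open StaircaseUniqueness Q.powerSeriesRing using (m⊛-zero; m⊛-suc; staircase-unique)

  acceptedSeries : Step → ℕ → XS
  acceptedSeries s h n m = + acceptedCount s h n m

  qpow-⊛-pos : ∀ h (c : ℕ → ℕ) m → (qpow h Q.⊛ (λ k → + c k)) m ≡ + qShift h c m
  qpow-⊛-pos h c m = trans (qpow-⊛ h (λ k → + c k) m) (sym (if-float +_ (h ≤ᵇ m)))

  pos-sumUpTo : ∀ n (f : ℕ → ℕ) → + ℕ∑.sumUpTo n f ≡ Q.sumUpTo n (λ k → + f k)
  pos-sumUpTo zero    f = refl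
  pos-sumUpTo (suc n) f = trans (ℤ.pos-+ (f 0) _) (cong (λ s → + f 0 +ℤ s) (pos-sumUpTo n (λ k → f (suc k))))

  F D : ℕ → XS
  F = acceptedSeries rise
  D = acceptedSeries fall

  D-rec : ∀ h → D h X.≋ monomial h X.⊛ F (suc h)
  D-rec h = X.coeffwise λ where
    zero    → QR.sym (m⊛-zero monomial qpow monomial≋ h (F (suc h)))
    (suc n) → QR.trans (Q.coeffwise λ m → sym (qpow-⊛-pos h (acceptedCount rise (suc h) n) m))
                       (QR.sym (m⊛-suc monomial qpow monomial≋ h (F (suc h)) n))

  F-rec : ∀ h → F h X.≋ X.𝟙 X.⊕ monomial h X.⊛ F (suc h) X.⊕ X.∑Series.sumUpTo (suc h) (λ y → monomial y X.⊛ D y)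
  F-rec h = X.coeffwise coeff-at
    where
    ∑m⊛D = X.∑Series.sumUpTo (suc h) (λ y → monomial y X.⊛ D y)
    F-zero : F h 0 Q.≋ Q.𝟙
    F-zero = Q.coeffwise λ where
      zero    → refl
      (suc _) → refl
    coeff-at-suc : ∀ n m → F h (suc n) m ≡ (X.𝟙 X.⊕ monomial h X.⊛ F (suc h) X.⊕ ∑m⊛D) (suc n) m
    coeff-at-suc n m = begin
      + acceptedCount rise h (suc n) m
        ≡⟨ ℤ.pos-+ (qShift h (acceptedCount rise (suc h) n) m) (ℕ∑.sumUpTo (suc h) falls) ⟩
      + qShift h (acceptedCount rise (suc h) n) m +ℤ + ℕ∑.sumUpTo (suc h) falls
        ≡⟨ cong₂ _+ℤ_ (sym (qpow-⊛-pos h (acceptedCount rise (suc h) n) m)) (pos-sumUpTo (suc h) falls) ⟩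
      (qpow h Q.⊛ F (suc h) n) m +ℤ Q.sumUpTo (suc h) (λ y → + qShift y (acceptedCount fall y n) m)
        ≡⟨ cong₂ _+ℤ_ (Q.coeff (QR.sym (m⊛-suc monomial qpow monomial≋ h (F (suc h)) n)) m) ∑-coeff ⟩
      (monomial h X.⊛ F (suc h)) (suc n) m +ℤ ∑m⊛D (suc n) m
        ≡⟨ ℤ.+-identityˡ ((monomial h X.⊛ F (suc h)) (suc n) m +ℤ ∑m⊛D (suc n) m) ⟨
      + 0 +ℤ ((monomial h X.⊛ F (suc h)) (suc n) m +ℤ ∑m⊛D (suc n) m)
        ≡⟨ ℤ.+-assoc (+ 0) ((monomial h X.⊛ F (suc h)) (suc n) m) (∑m⊛D (suc n) m) ⟨
      (X.𝟙 X.⊕ monomial h X.⊛ F (suc h) X.⊕ ∑m⊛D) (suc n) m     ∎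
      where
      open Relation.Binary.PropositionalEquality.≡-Reasoning
      falls : ℕ → ℕ
      falls y = qShift y (acceptedCount fall y n) m
      ∑-coeff : Q.sumUpTo (suc h) (λ y → + qShift y (acceptedCount fall y n) m) ≡ ∑m⊛D (suc n) m
      ∑-coeff = sym (trans (Q.coeff (X.sumUpTo-coeff (suc h) (λ y → monomial y X.⊛ D y) (suc n)) m)
                    (trans (Q.sumUpTo-coeff (suc h) (λ y → (monomial y X.⊛ D y) (suc n)) m)
                           (Q.sumUpTo-cong (suc h) λ y →
                              trans (Q.coeff (m⊛-suc monomial qpow monomial≋ y (D y) n) m)
                                    (qpow-⊛-pos y (acceptedCount fall y n) m))))
    coeff-at : ∀ n → F h n Q.≋ (X.𝟙 X.⊕ monomial h X.⊛ F (suc h) X.⊕ ∑m⊛D) n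
    coeff-at zero = begin
      F h 0                                            ≈⟨ F-zero ⟩
      Q.𝟙                                              ≈⟨ QR.+-identityʳ Q.𝟙 ⟨
      Q.𝟙 Q.⊕ Q.𝟘                                      ≈⟨ QR.+-identityʳ (Q.𝟙 Q.⊕ Q.𝟘) ⟨
      Q.𝟙 Q.⊕ Q.𝟘 Q.⊕ Q.𝟘                              ≈⟨ QR.+-cong (QR.+-congˡ {Q.𝟙} (QR.sym m⊛F≋0)) (QR.sym ∑≋0) ⟩
      (X.𝟙 X.⊕ monomial h X.⊛ F (suc h) X.⊕ ∑m⊛D) 0   ∎
      where
      open import Relation.Binary.Reasoning.Setoid QR.setoid
      m⊛F≋0 = m⊛-zero monomial qpow monomial≋ h (F (suc h))
      ∑≋0 : ∑m⊛D 0 Q.≋ Q.𝟘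
      ∑≋0 = QR.trans (X.sumUpTo-coeff (suc h) (λ y → monomial y X.⊛ D y) 0)
                     (X.sumUpTo-zero (suc h) (λ y _ → m⊛-zero monomial qpow monomial≋ y (D y)))
    coeff-at (suc n) = Q.coeffwise (coeff-at-suc n)

  open Staircase X.powerSeriesRing using (module ProductTransform)
  open ProductTransform monomial F D F-rec D-rec using (staircase-prefixProduct)

  F₀≋W⊛α₀ : F 0 X.≋ W X.⊛ α 0
  F₀≋W⊛α₀ = XR.trans (XR.sym (XR.*-identityˡ (F 0)))
    (staircase-unique monomial qpow monomial≋ staircase-prefixProduct staircase-W⊛α 0)

open Words using (Hcoeff-suc)
open RightHandSide using (module Q; module X; W; α; rhs≋shift-W⊛α₀)
open LeftHandSide using (F; F₀≋W⊛α₀)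

theorem5p2 : (n m : ℕ) → Hcoeff n m ≡ rhs n m
theorem5p2 zero    m = ≡.sym (Q.coeff (X.coeff rhs≋shift-W⊛α₀ 0) m)
theorem5p2 (suc n) m = begin
  Hcoeff (suc n) m              ≡⟨ Hcoeff-suc n m ⟩
  F 0 n m                       ≡⟨ Q.coeff (X.coeff F₀≋W⊛α₀ n) m ⟩
  (W X.⊛ α 0) n m               ≡⟨ Q.coeff (X.coeff rhs≋shift-W⊛α₀ (suc n)) m ⟨
  rhs (suc n) m                 ∎
  where open Relation.Binary.PropositionalEquality.≡-Reasoning
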